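{- Let $d\geq 3$, $1\leq k\leq n$, $1\leq r\leq d$ and let $\tau:[d]\to[r]$ be a surjection. Then the polynomials $\gamma_{u_1\cdots u_d}$, $(u_1,\ldots,u_d)\in U_\tau$, form a basis of the real vector space of polynomials in the $r$ variables $x_{1_\tau},\ldots,x_{r_\tau}$ of total degree at most $k-r$.
   Context: $[m]=\{1,\ldots,m\}$. $U_\tau\subseteq[k]^d$ is the set of $(u_1,\ldots,u_d)$ with the same relative order as $(\tau(1),\ldots,\tau(d))$: for all $j_1<j_2$, $u_{j_1}<u_{j_2}$, $=$, $>$ according as $\tau(j_1)<\tau(j_2)$, $=$, $>$. For $1\leq s\leq r$ let $s_\tau=\min\tau^{ -1}(s)$. For $(u_1,\ldots,u_d)\in U_\tau$, \[\gamma_{u_1\cdots u_d}(x_1,\ldots,x_d)=\binom{x_{1_\tau}-1}{u_{1_\tau}-1}\binom{x_{2_\tau}-x_{1_\tau}-1}{u_{2_\tau}-u_{1_\tau}-1}\cdots\binom{x_{r_\tau}-x_{(r-1)_\tau}-1}{u_{r_\tau}-u_{(r-1)_\tau}-1}\binom{n-x_{r_\tau}}{k-u_{r_\tau}},\] where $\binom{y}{m}=y(y-1)\cdots(y-m+1)/m!$ is viewed as a polynomial in $y$.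
   Formalization: The space of polynomials of total degree at most $k-r$ is taken over ℚ instead of the reals, so coefficients, spanning combinations and linear independence are rational. -}

module Defs where

open import Data.Nat as ℕ using (ℕ; zero; suc; _≤_; _<_; _∸_)
open import Data.Nat.Properties using (_!≢0)
open import Data.Integer using (+_)
open import Data.Rational as ℚ using (ℚ; 0ℚ; 1ℚ)
open import Data.Fin as Fin using (Fin; toℕ; inject₁; fromℕ)
open import Data.Vec as Vec using (Vec; lookup; replicate; zipWith; tabulate)
open import Data.Vec.Properties using (≡-dec)
open import Data.List as List using (List; []; _∷_; _++_; concatMap; foldr; allFin; upTo)
open import Data.Maybe as Maybe using (Maybe; just; nothing; maybe)
open import Data.Product using (_×_; _,_; proj₁; proj₂; ∃)
open import Data.List.Relation.Unary.All using (All)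
open import Data.List.Relation.Unary.Unique.Propositional using (Unique)
open import Relation.Nullary using (yes; no; ¬_)
open import Relation.Binary.PropositionalEquality using (_≡_)

-- A polynomial is a formal finite sum of terms  c · X^e  (c : ℚ, e : Vec ℕ r);
-- its coefficient at the monomial X^e is the sum of the c's of terms with exponent e.

Poly : ℕ → Set
Poly r = List (ℚ × Vec ℕ r)

coeff : ∀ {r} → Poly r → Vec ℕ r → ℚ
coeff []             e = 0ℚ
coeff ((c , e') ∷ p) e with ≡-dec ℕ._≟_ e' e
... | yes _ = c ℚ.+ coeff p e
... | no  _ = coeff p e

_≈ₚ_ : ∀ {r} → Poly r → Poly r → Set
p ≈ₚ q = ∀ e → coeff p e ≡ coeff q e

zeroₚ : ∀ {r} → Poly r
zeroₚ = []

constₚ : ∀ {r} → ℚ → Poly r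
constₚ c = (c , replicate _ 0) ∷ []

var : ∀ {r} → Fin r → Poly r
var s = (1ℚ , tabulate (λ i → ind i)) ∷ []
  where
  ind : _ → ℕ
  ind i with Fin._≟_ i s
  ... | yes _ = 1
  ... | no  _ = 0

_+ₚ_ : ∀ {r} → Poly r → Poly r → Poly r
p +ₚ q = p ++ q

scaleₚ : ∀ {r} → ℚ → Poly r → Poly r
scaleₚ a p = List.map (λ t → (a ℚ.* proj₁ t , proj₂ t)) p

_-ₚ_ : ∀ {r} → Poly r → Poly r → Poly r
p -ₚ q = p +ₚ scaleₚ (ℚ.- 1ℚ) q

_*ₚ_ : ∀ {r} → Poly r → Poly r → Poly r
p *ₚ q = concatMap (λ t → List.map (λ t' → (proj₁ t ℚ.* proj₁ t' , zipWith ℕ._+_ (proj₂ t) (proj₂ t'))) q) p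

prodₚ : ∀ {r} → List (Poly r) → Poly r
prodₚ = foldr _*ₚ_ (constₚ 1ℚ)

ℕtoℚ : ℕ → ℚ
ℕtoℚ m = + m ℚ./ 1

binomₚ : ∀ {r} → Poly r → ℕ → Poly r
binomₚ y m = scaleₚ ((+ 1 ℚ./ (m ℕ.!)) {{m !≢0}})
                    (prodₚ (List.map (λ i → y -ₚ constₚ (ℕtoℚ i)) (upTo m)))

-- total degree at most D, where D = k - r is an integer, possibly negative:
-- every monomial with nonzero coefficient has  |e| + r ≤ k.
DegreeAtMost : ∀ {r} → (k : ℕ) → Poly r → Set
DegreeAtMost {r} k p = ∀ e → ¬ (coeff p e ≡ 0ℚ) → Vec.sum e ℕ.+ r ≤ k

-- u ∈ U_τ : entries in [k] = {1..k} with the same relative order as (τ(1),…,τ(d))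
InU : ∀ {d r} → (k : ℕ) → (Fin d → Fin r) → Vec ℕ d → Set
InU {d} k τ u =
  (∀ j → 1 ≤ lookup u j × lookup u j ≤ k) ×
  (∀ j₁ j₂ → toℕ j₁ < toℕ j₂ →
     (toℕ (τ j₁) < toℕ (τ j₂) → lookup u j₁ < lookup u j₂) ×
     (τ j₁ ≡ τ j₂ → lookup u j₁ ≡ lookup u j₂) ×
     (toℕ (τ j₂) < toℕ (τ j₁) → lookup u j₂ < lookup u j₁))

-- s_τ = min τ⁻¹(s)  (nothing if the preimage is empty; never happens for surjective τ)
minPre : ∀ {d r} → (Fin d → Fin r) → Fin r → Maybe (Fin d)
minPre {zero}  τ s = nothing
minPre {suc d} τ s with Fin._≟_ (τ Fin.zero) s
... | yes _ = just Fin.zero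
... | no  _ = Maybe.map Fin.suc (minPre (λ j → τ (Fin.suc j)) s)

uAt : ∀ {d r} → (Fin d → Fin r) → Vec ℕ d → Fin r → ℕ
uAt τ u s = maybe (lookup u) 0 (minPre τ s)

-- γ_u as a polynomial in the r variables; variable X_s stands for x_{s_τ}.
--  γ = C(x_{1τ}-1, u_{1τ}-1) · Π_{s=2}^{r} C(x_{sτ}-x_{(s-1)τ}-1, u_{sτ}-u_{(s-1)τ}-1) · C(n-x_{rτ}, k-u_{rτ})
γ : ∀ {d r} → (n k : ℕ) → (Fin d → Fin r) → Vec ℕ d → Poly r
γ {d} {zero}   n k τ u = constₚ 1ℚ  -- r = 0 is excluded by hypothesis
γ {d} {suc r'} n k τ u =
  binomₚ (var Fin.zero -ₚ constₚ 1ℚ) (U Fin.zero ∸ 1)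
  *ₚ (prodₚ (List.map (λ (i : Fin r') →
          binomₚ ((var (Fin.suc i) -ₚ var (inject₁ i)) -ₚ constₚ 1ℚ)
                 (U (Fin.suc i) ∸ U (inject₁ i) ∸ 1)) (allFin r'))
  *ₚ binomₚ (constₚ (ℕtoℚ n) -ₚ var (fromℕ r')) (k ∸ U (fromℕ r')))
  where
  U : Fin (suc r') → ℕ
  U = uAt τ u

combₚ : ∀ {d r} → (Vec ℕ d → Poly r) → List (ℚ × Vec ℕ d) → Poly r
combₚ f = foldr (λ t acc → scaleₚ (proj₁ t) (f (proj₂ t)) +ₚ acc) zeroₚ

record IsBasis {d r : ℕ} (Idx : Vec ℕ d → Set) (f : Vec ℕ d → Poly r)
               (Space : Poly r → Set) : Set where
  field
    members  : ∀ u → Idx u → Space (f u)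
    spanning : ∀ p → Space p →
                 ∃ λ (L : List (ℚ × Vec ℕ d)) →
                   All (λ t → Idx (proj₂ t)) L × (combₚ f L ≈ₚ p)
    independent : ∀ (L : List (ℚ × Vec ℕ d)) →
                 All (λ t → Idx (proj₂ t)) L →
                 Unique (List.map proj₂ L) →
                 combₚ f L ≈ₚ zeroₚ →
                 All (λ t → proj₁ t ≡ 0ℚ) L

module Submission where

-- The map u ↦ U = (u_{1τ}, …, u_{rτ}) identifies U_τ with the strictly increasing sequences
-- 1 ≤ U₁ < ⋯ < U_r ≤ k, and γ_u only depends on U.  As a product of k − r linear factors, γ_U
-- has degree at most k − r.  At the lattice point x = V of another such sequence with V_r ≤ n,
--   γ_U(V) = C(V₁−1, U₁−1) · ∏ₛ C(V_{s+1}−V_s−1, U_{s+1}−U_s−1) · C(n−V_r, k−U_r),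
-- which vanishes unless U ≤ V coordinatewise, and is nonzero at V = U because k ≤ n.  This
-- triangularity with respect to the weight ∑ U_s gives linear independence.  Spanning is a count:
-- U_s = ∑_{t ≤ s} (e_t + 1) maps the exponent vectors e of total degree at most k − r injectively
-- into U_τ, so there are at least as many γ's as monomials, and that many independent vectors in
-- the span of the monomials span it.

open import Defs
open import Data.Nat using (ℕ; _≤_)
open import Data.Fin using (Fin)
open import Function.Definitions using (Surjective)
open import Relation.Binary.PropositionalEquality using (_≡_)

open import Algebra.Bundles using (CommutativeRing)
open import Data.Nat.Base as ℕ using (zero; suc; _<_; _∸_; z≤n; s≤s)
import Data.Nat.Properties as ℕ
import Data.Nat.ListAction as ℕ
open import Data.Nat.Tactic.RingSolver using (solve-∀)
open import Data.Nat.Induction using (<-rec)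
import Data.Nat.Coprimality as Coprime
open import Data.Integer.Base as ℤ using (+_)
import Data.Integer.Properties as ℤ
open import Data.Rational.Base as ℚ using (ℚ; 0ℚ; 1ℚ; mkℚ)
import Data.Rational.Properties as ℚ
import Data.Rational.Unnormalised.Base as ℚᵘ
import Data.Rational.Unnormalised.Properties as ℚᵘ
open import Data.Rational.Solver using (module +-*-Solver)
open import Data.Fin.Base as Fin using (zero; suc; toℕ; inject₁; fromℕ; punchIn)
import Data.Fin.Properties as Fin
open import Data.Vec.Base as Vec using (Vec; []; _∷_; lookup; zipWith; replicate)
import Data.Vec.Properties as Vec
open import Data.Vec.Properties using (≡-dec)
open import Data.Vec.Functional using (insertAt)
open import Data.Vec.Functional.Properties using (insertAt-lookup; insertAt-punchIn)
open import Data.List.Base as List using (List; []; _∷_; _++_; [_]; upTo; allFin)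
import Data.List.Properties as List
open import Data.List.Relation.Unary.All as All using (All; []; _∷_)
import Data.List.Relation.Unary.All.Properties as All
open import Data.List.Relation.Unary.Any using (here; there)
open import Data.List.Relation.Unary.AllPairs using ([]; _∷_)
open import Data.List.Relation.Unary.Unique.Propositional using (Unique)
import Data.List.Relation.Unary.Unique.Propositional.Properties as Unique
open import Data.List.Relation.Unary.Unique.DecPropositional.Properties using (deduplicate-!)
open import Data.List.Membership.Propositional using (_∈_)
import Data.List.Membership.Propositional.Properties as ∈
open import Data.Maybe.Base as Maybe using (just)
open import Data.Product.Base using (_×_; _,_; proj₁; proj₂; ∃)
open import Data.Sum.Base using (_⊎_; inj₁; inj₂)
open import Data.Empty using (⊥)
open import Function.Base using (_∘_; _∋_; case_of_)
open import Relation.Binary.Definitions using (tri<; tri≈; tri>)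
open import Relation.Binary.PropositionalEquality
  using (_≢_; refl; sym; trans; cong; cong₂; subst; module ≡-Reasoning)
open import Relation.Nullary using (Dec; yes; no; ¬_; ¬?; contradiction)
open import Relation.Nullary.Decidable using (decidable-stable)

open import Algebra.Properties.CommutativeSemigroup ℕ.+-commutativeSemigroup
  using () renaming (interchange to +-interchange)
open import Algebra.Properties.Semiring.Exp (CommutativeRing.semiring ℚ.+-*-commutativeRing)
  using (_^_; ^-homo-*)
open import Algebra.Properties.Semiring.Sum (CommutativeRing.semiring ℚ.+-*-commutativeRing)
  using (sum; sum-cong-≗; sum-replicate-zero; sum-remove; ∑-distrib-+; *-distribˡ-sum; *-distribʳ-sum)
open +-*-Solver using (solve; _:=_; _:+_; _:*_; _:-_; :-_; con)

m∸1≤n∸1⇒m≤n : ∀ {m n} → 1 ≤ n → m ∸ 1 ≤ n ∸ 1 → m ≤ n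
m∸1≤n∸1⇒m≤n {zero}          _ _   = z≤n
m∸1≤n∸1⇒m≤n {suc m} {suc n} _ m≤n = s≤s m≤n

1+m+[n∸m∸1]≡n : ∀ {m n} → m < n → suc (m ℕ.+ (n ∸ m ∸ 1)) ≡ n
1+m+[n∸m∸1]≡n {zero}  {suc n} _         = refl
1+m+[n∸m∸1]≡n {suc m} {suc n} (s≤s m<n) = cong suc (1+m+[n∸m∸1]≡n m<n)

sum-map-allFin-suc : ∀ m (g : Fin (suc m) → ℕ) →
                     ℕ.sum (List.map g (allFin (suc m))) ≡ g zero ℕ.+ ℕ.sum (List.map (g ∘ suc) (allFin m))
sum-map-allFin-suc m g = cong (λ xs → g zero ℕ.+ ℕ.sum xs)
  (trans (List.map-tabulate suc g) (sym (List.map-tabulate (λ i → i) (g ∘ suc))))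

sum-map-mono-≤ : ∀ {A : Set} {f g : A → ℕ} xs → (∀ a → f a ≤ g a) →
                 ℕ.sum (List.map f xs) ≤ ℕ.sum (List.map g xs)
sum-map-mono-≤ []       f≤g = z≤n
sum-map-mono-≤ (x ∷ xs) f≤g = ℕ.+-mono-≤ (f≤g x) (sum-map-mono-≤ xs f≤g)

sum-map-≤∧≡⇒≡ : ∀ {A : Set} {f g : A → ℕ} xs → (∀ a → f a ≤ g a) →
                ℕ.sum (List.map f xs) ≡ ℕ.sum (List.map g xs) → All (λ a → f a ≡ g a) xs
sum-map-≤∧≡⇒≡                []       f≤g _  = []
sum-map-≤∧≡⇒≡ {f = f} {g} (x ∷ xs) f≤g eq =
  fx≡gx ∷ sum-map-≤∧≡⇒≡ xs f≤g (ℕ.+-cancelˡ-≡ (f x) _ _ (trans eq (cong (ℕ._+ _) (sym fx≡gx))))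
  where
  fx≡gx : f x ≡ g x
  fx≡gx = ℕ.≤-antisym (f≤g x) (ℕ.≮⇒≥ λ fx<gx → ℕ.<⇒≢ (ℕ.+-mono-<-≤ fx<gx (sum-map-mono-≤ xs f≤g)) eq)

ℕtoℚ≡mkℚ : ∀ m → ℕtoℚ m ≡ mkℚ (+ m) 0 (Coprime.sym (Coprime.1-coprimeTo m))
ℕtoℚ≡mkℚ m = ℚ.normalize-coprime (Coprime.sym (Coprime.1-coprimeTo m))

ℕtoℚ-suc : ∀ m → ℕtoℚ (suc m) ≡ 1ℚ ℚ.+ ℕtoℚ m
ℕtoℚ-suc m = ℚ.toℚᵘ-injective (begin-≃
  ℚ.toℚᵘ (ℕtoℚ (suc m))         ≡⟨ cong ℚ.toℚᵘ (ℕtoℚ≡mkℚ (suc m)) ⟩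
  ℚᵘ.mkℚᵘ (+ suc m) 0            ≈⟨ ℚᵘ.*≡* cross-multiplied ⟩
  ℚᵘ.1ℚᵘ ℚᵘ.+ ℚᵘ.mkℚᵘ (+ m) 0     ≡⟨ cong (λ q → ℚᵘ.1ℚᵘ ℚᵘ.+ ℚ.toℚᵘ q) (ℕtoℚ≡mkℚ m) ⟨
  ℚᵘ.1ℚᵘ ℚᵘ.+ ℚ.toℚᵘ (ℕtoℚ m)     ≈⟨ ℚ.toℚᵘ-homo-+ 1ℚ (ℕtoℚ m) ⟨
  ℚ.toℚᵘ (1ℚ ℚ.+ ℕtoℚ m)         ∎)
  where
  open ℚᵘ.≃-Reasoning renaming (begin_ to begin-≃_)
  cross-multiplied : + suc m ℤ.* ℚᵘ.↧ (ℚᵘ.1ℚᵘ ℚᵘ.+ ℚᵘ.mkℚᵘ (+ m) 0)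
                   ≡ ℚᵘ.↥ (ℚᵘ.1ℚᵘ ℚᵘ.+ ℚᵘ.mkℚᵘ (+ m) 0) ℤ.* ℚᵘ.↧ (ℚᵘ.mkℚᵘ (+ suc m) 0)
  cross-multiplied = trans (ℤ.*-identityʳ (+ suc m))
                           (sym (trans (ℤ.*-identityʳ _) (cong (ℤ._+_ (+ 1)) (ℤ.*-identityʳ (+ m)))))

ℕtoℚ-+ : ∀ a b → ℕtoℚ (a ℕ.+ b) ≡ ℕtoℚ a ℚ.+ ℕtoℚ b
ℕtoℚ-+ zero    b = sym (ℚ.+-identityˡ (ℕtoℚ b))
ℕtoℚ-+ (suc a) b = begin
  ℕtoℚ (suc (a ℕ.+ b))         ≡⟨ ℕtoℚ-suc (a ℕ.+ b) ⟩
  1ℚ ℚ.+ ℕtoℚ (a ℕ.+ b)        ≡⟨ cong (1ℚ ℚ.+_) (ℕtoℚ-+ a b) ⟩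
  1ℚ ℚ.+ (ℕtoℚ a ℚ.+ ℕtoℚ b)   ≡⟨ ℚ.+-assoc 1ℚ (ℕtoℚ a) (ℕtoℚ b) ⟨
  (1ℚ ℚ.+ ℕtoℚ a) ℚ.+ ℕtoℚ b   ≡⟨ cong (ℚ._+ ℕtoℚ b) (ℕtoℚ-suc a) ⟨
  ℕtoℚ (suc a) ℚ.+ ℕtoℚ b      ∎
  where open ≡-Reasoning

ℕtoℚ-∸ : ∀ {a b} → b ≤ a → ℕtoℚ a ℚ.- ℕtoℚ b ≡ ℕtoℚ (a ∸ b)
ℕtoℚ-∸ {a} {b} b≤a = begin
  ℕtoℚ a ℚ.- ℕtoℚ b                      ≡⟨ cong (λ c → ℕtoℚ c ℚ.- ℕtoℚ b) (ℕ.m+[n∸m]≡n b≤a) ⟨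
  ℕtoℚ (b ℕ.+ (a ∸ b)) ℚ.- ℕtoℚ b        ≡⟨ cong (ℚ._- ℕtoℚ b) (ℕtoℚ-+ b (a ∸ b)) ⟩
  (ℕtoℚ b ℚ.+ ℕtoℚ (a ∸ b)) ℚ.- ℕtoℚ b   ≡⟨ solve 2 (λ x y → (x :+ y) :- x := y) refl (ℕtoℚ b) (ℕtoℚ (a ∸ b)) ⟩
  ℕtoℚ (a ∸ b)                           ∎
  where open ≡-Reasoning

ℕtoℚ≢0 : ∀ {m} → 0 < m → ℕtoℚ m ≢ 0ℚ
ℕtoℚ≢0 {suc m} _ eq = case trans (sym (ℕtoℚ≡mkℚ (suc m))) eq of λ ()

p*q≡0⇒p≡0 : ∀ {p q} → q ≢ 0ℚ → p ℚ.* q ≡ 0ℚ → p ≡ 0ℚ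
p*q≡0⇒p≡0 {p} {q} q≢0 pq≡0 = begin
  p                      ≡⟨ ℚ.*-identityʳ p ⟨
  p ℚ.* 1ℚ               ≡⟨ cong (p ℚ.*_) (ℚ.*-inverseʳ q) ⟨
  p ℚ.* (q ℚ.* ℚ.1/ q)   ≡⟨ ℚ.*-assoc p q (ℚ.1/ q) ⟨
  (p ℚ.* q) ℚ.* ℚ.1/ q   ≡⟨ cong (ℚ._* ℚ.1/ q) pq≡0 ⟩
  0ℚ ℚ.* ℚ.1/ q          ≡⟨ ℚ.*-zeroˡ (ℚ.1/ q) ⟩
  0ℚ                     ∎
  where
  open ≡-Reasoning
  instance _ = ℚ.≢-nonZero q≢0

p≢0∧q≢0⇒p*q≢0 : ∀ {p q} → p ≢ 0ℚ → q ≢ 0ℚ → p ℚ.* q ≢ 0ℚ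
p≢0∧q≢0⇒p*q≢0 p≢0 q≢0 = p≢0 ∘ p*q≡0⇒p≡0 q≢0

p*q≢0⇒p≢0 : ∀ {p} q → p ℚ.* q ≢ 0ℚ → p ≢ 0ℚ
p*q≢0⇒p≢0 q pq≢0 refl = pq≢0 (ℚ.*-zeroˡ q)

p*q≢0⇒q≢0 : ∀ p {q} → p ℚ.* q ≢ 0ℚ → q ≢ 0ℚ
p*q≢0⇒q≢0 p pq≢0 refl = pq≢0 (ℚ.*-zeroʳ p)

product : List ℚ → ℚ
product = List.foldr ℚ._*_ 1ℚ

product-0 : ∀ {xs} → 0ℚ ∈ xs → product xs ≡ 0ℚ
product-0 {x ∷ xs} (here refl)  = ℚ.*-zeroˡ (product xs)
product-0 {x ∷ xs} (there 0∈xs) = trans (cong (x ℚ.*_) (product-0 0∈xs)) (ℚ.*-zeroʳ x)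

product-≢0 : ∀ {xs} → All (_≢ 0ℚ) xs → product xs ≢ 0ℚ
product-≢0 []         = λ ()
product-≢0 (x≢0 ∷ xs) = p≢0∧q≢0⇒p*q≢0 x≢0 (product-≢0 xs)

product≢0⇒≢0 : ∀ xs → product xs ≢ 0ℚ → All (_≢ 0ℚ) xs
product≢0⇒≢0 []       _  = []
product≢0⇒≢0 (x ∷ xs) ≢0 = p*q≢0⇒p≢0 (product xs) ≢0 ∷ product≢0⇒≢0 xs (p*q≢0⇒q≢0 x ≢0)

1/_! : ℕ → ℚ
1/ m ! = (+ 1 ℚ./ (m ℕ.!)) {{m ℕ.!≢0}}

1/!≢0 : ∀ m → 1/ m ! ≢ 0ℚ
1/!≢0 m eq = case subst ℚ.NonZero eq (ℚ.pos⇒nonZero (1/ m !) {{ℚ.normalize-pos 1 (m ℕ.!) {{m ℕ.!≢0}}}}) of λ ()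

_choose_ : ℚ → ℕ → ℚ
y choose m = 1/ m ! ℚ.* product (List.map (λ i → y ℚ.- ℕtoℚ i) (upTo m))

-- The natural numbers in the next three lemmas are explicit: inferring them from a value of
-- _choose_ makes the unifier unfold the normalisation of rationals.
choose-< : ∀ a m → a < m → ℕtoℚ a choose m ≡ 0ℚ
choose-< a m a<m = trans (cong (1/ m ! ℚ.*_) (product-0 0∈factors)) (ℚ.*-zeroʳ (1/ m !))
  where
  factors : List ℚ
  factors = List.map (λ i → ℕtoℚ a ℚ.- ℕtoℚ i) (upTo m)

  0∈factors : 0ℚ ∈ factors
  0∈factors = subst (_∈ factors) (trans (ℕtoℚ-∸ {a} ℕ.≤-refl) (cong ℕtoℚ (ℕ.n∸n≡0 a)))
                    (∈.∈-map⁺ (λ i → ℕtoℚ a ℚ.- ℕtoℚ i) (∈.∈-upTo⁺ a<m))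

choose-≢0 : ∀ a m → m ≤ a → ℕtoℚ a choose m ≢ 0ℚ
choose-≢0 a m m≤a = p≢0∧q≢0⇒p*q≢0 (1/!≢0 m) (product-≢0 (All.map⁺ (All.tabulate factor≢0)))
  where
  factor≢0 : ∀ {i} → i ∈ upTo m → ℕtoℚ a ℚ.- ℕtoℚ i ≢ 0ℚ
  factor≢0 i∈ with ℕ.<-≤-trans (∈.∈-upTo⁻ i∈) m≤a
  ... | i<a = subst (_≢ 0ℚ) (sym (ℕtoℚ-∸ (ℕ.<⇒≤ i<a))) (ℕtoℚ≢0 (ℕ.m<n⇒0<n∸m i<a))

choose≢0⇒≤ : ∀ a m → ℕtoℚ a choose m ≢ 0ℚ → m ≤ a
choose≢0⇒≤ a m ≢0 = ℕ.≮⇒≥ (≢0 ∘ choose-< a m)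

-- Finite sums and linear algebra over ℚ

sumOver : ∀ {A : Set} → List A → (A → ℚ) → ℚ
sumOver []      f = 0ℚ
sumOver (a ∷ S) f = f a ℚ.+ sumOver S f

sumOver-+ : ∀ {A : Set} (S : List A) f g → sumOver S (λ a → f a ℚ.+ g a) ≡ sumOver S f ℚ.+ sumOver S g
sumOver-+ []      f g = refl
sumOver-+ (a ∷ S) f g rewrite sumOver-+ S f g =
  solve 4 (λ u v w z → (u :+ v) :+ (w :+ z) := (u :+ w) :+ (v :+ z)) refl (f a) (g a) (sumOver S f) (sumOver S g)

sumOver-cong : ∀ {A : Set} (S : List A) {f g} → (∀ a → f a ≡ g a) → sumOver S f ≡ sumOver S g
sumOver-cong []      f≗g = refl
sumOver-cong (a ∷ S) f≗g = cong₂ ℚ._+_ (f≗g a) (sumOver-cong S f≗g)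

sumOver-0 : ∀ {A : Set} (S : List A) {f} → All (λ a → f a ≡ 0ℚ) S → sumOver S f ≡ 0ℚ
sumOver-0 []      []           = refl
sumOver-0 (_ ∷ S) (fa≡0 ∷ all) = trans (cong₂ ℚ._+_ fa≡0 (sumOver-0 S all)) (ℚ.+-identityˡ 0ℚ)

sumOver-concentrated : ∀ {A K : Set} (key : A → K) {S : List A} {f a} → Unique (List.map key S) → a ∈ S →
                       (∀ {b} → b ∈ S → key b ≢ key a → f b ≡ 0ℚ) → sumOver S f ≡ f a
sumOver-concentrated key {b ∷ S} {f} (b∉S ∷ _) (here refl) vanish =
  trans (cong (f b ℚ.+_) (sumOver-0 S (All.tabulate λ b'∈S → vanish (there b'∈S) (key≢ b'∈S ∘ sym))))
        (ℚ.+-identityʳ (f b))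
  where
  key≢ : ∀ {b'} → b' ∈ S → key b ≢ key b'
  key≢ = All.lookup (All.map⁻ b∉S)
sumOver-concentrated key {b ∷ S} {f} (b∉S ∷ unique) (there a∈S) vanish =
  trans (cong (ℚ._+ sumOver S f) (vanish (here refl) (All.lookup (All.map⁻ b∉S) a∈S)))
        (trans (ℚ.+-identityˡ (sumOver S f)) (sumOver-concentrated key unique a∈S (vanish ∘ there)))

module _ {I : Set} (Idx : I → Set) (weight : I → ℕ) (ev : I → I → ℚ)
         (ev-diagonal   : ∀ v → Idx v → ev v v ≢ 0ℚ)
         (ev-triangular : ∀ u v → Idx u → Idx v → ev u v ≢ 0ℚ → u ≢ v → weight u < weight v) where

  triangular⇒independent : ∀ (L : List (ℚ × I)) → All (Idx ∘ proj₂) L → Unique (List.map proj₂ L) →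
                           (∀ v → Idx v → sumOver L (λ t → proj₁ t ℚ.* ev (proj₂ t) v) ≡ 0ℚ) →
                           All (λ t → proj₁ t ≡ 0ℚ) L
  triangular⇒independent L L⊆Idx unique vanish = All.tabulate λ t∈L → <-rec ZeroAtWeight zero-at _ t∈L refl
    where
    ZeroAtWeight : ℕ → Set
    ZeroAtWeight w = ∀ {t} → t ∈ L → weight (proj₂ t) ≡ w → proj₁ t ≡ 0ℚ

    zero-at : ∀ w → (∀ {w'} → w' < w → ZeroAtWeight w') → ZeroAtWeight w
    zero-at _ lighter {c , u} t∈L refl = p*q≡0⇒p≡0 (ev-diagonal u u∈Idx) (trans (sym concentrated) (vanish u u∈Idx))
      where
      u∈Idx : Idx u
      u∈Idx = All.lookup L⊆Idx t∈L

      other-terms-vanish : ∀ {t'} → t' ∈ L → proj₂ t' ≢ u → proj₁ t' ℚ.* ev (proj₂ t') u ≡ 0ℚ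
      other-terms-vanish {c' , u'} t'∈L u'≢u with ev u' u ℚ.≟ 0ℚ
      ... | yes ev≡0 = trans (cong (c' ℚ.*_) ev≡0) (ℚ.*-zeroʳ c')
      ... | no  ev≢0 = trans (cong (ℚ._* ev u' u) c'≡0) (ℚ.*-zeroˡ (ev u' u))
        where
        c'≡0 : c' ≡ 0ℚ
        c'≡0 = lighter (ev-triangular u' u (All.lookup L⊆Idx t'∈L) u∈Idx ev≢0 u'≢u) t'∈L refl

      concentrated : sumOver L (λ t → proj₁ t ℚ.* ev (proj₂ t) u) ≡ c ℚ.* ev u u
      concentrated = sumOver-concentrated proj₂ unique t∈L other-terms-vanish

lincomb : ∀ {K : Set} {m} → (Fin m → ℚ) → (Fin m → K → ℚ) → K → ℚ
lincomb c v κ = sum (λ i → c i ℚ.* v i κ)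

lincomb-0 : ∀ {K : Set} {m} (c : Fin m → ℚ) v (κ : K) → (∀ i → v i κ ≡ 0ℚ) → lincomb c v κ ≡ 0ℚ
lincomb-0 {m = m} c v κ vκ≡0 =
  trans (sum-cong-≗ λ i → trans (cong (c i ℚ.*_) (vκ≡0 i)) (ℚ.*-zeroʳ (c i))) (sum-replicate-zero m)

-- One step of Gaussian elimination on the equation at κ, with pivot v j κ.
module Pivot {K : Set} {m} (v : Fin (suc m) → K → ℚ) (κ : K) (j : Fin (suc m)) (vⱼκ≢0 : v j κ ≢ 0ℚ) where

  private
    instance _ = ℚ.≢-nonZero vⱼκ≢0
    a⁻¹ : ℚ
    a⁻¹ = ℚ.1/ v j κ

  reduced : Fin m → K → ℚ
  reduced i κ' = v (punchIn j i) κ' ℚ.- (v (punchIn j i) κ ℚ.* a⁻¹) ℚ.* v j κ'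

  reduced-vanishes : ∀ i → reduced i κ ≡ 0ℚ
  reduced-vanishes i = begin
    vᵢ ℚ.- (vᵢ ℚ.* a⁻¹) ℚ.* v j κ   ≡⟨ cong (ℚ._-_ vᵢ) (ℚ.*-assoc vᵢ a⁻¹ (v j κ)) ⟩
    vᵢ ℚ.- vᵢ ℚ.* (a⁻¹ ℚ.* v j κ)   ≡⟨ cong (λ z → vᵢ ℚ.- vᵢ ℚ.* z) (ℚ.*-inverseˡ (v j κ)) ⟩
    vᵢ ℚ.- vᵢ ℚ.* 1ℚ                ≡⟨ cong (ℚ._-_ vᵢ) (ℚ.*-identityʳ vᵢ) ⟩
    vᵢ ℚ.- vᵢ                       ≡⟨ ℚ.+-inverseʳ vᵢ ⟩
    0ℚ                              ∎
    where
    open ≡-Reasoning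
    vᵢ : ℚ
    vᵢ = v (punchIn j i) κ

  lift : (Fin m → ℚ) → Fin (suc m) → ℚ
  lift c = insertAt c j (ℚ.- (lincomb c (v ∘ punchIn j) κ ℚ.* a⁻¹))

  lift-punchIn : ∀ c i → lift c (punchIn j i) ≡ c i
  lift-punchIn c i = insertAt-punchIn c j (ℚ.- (lincomb c (v ∘ punchIn j) κ ℚ.* a⁻¹)) i

  lincomb-lift : ∀ c κ' → lincomb (lift c) v κ' ≡ lincomb c reduced κ'
  lincomb-lift c κ' = begin
    lincomb (lift c) v κ'
      ≡⟨ sum-remove {i = j} (λ i → lift c i ℚ.* v i κ') ⟩
    lift c j ℚ.* y ℚ.+ sum (λ i → lift c (punchIn j i) ℚ.* v (punchIn j i) κ')
      ≡⟨ cong₂ ℚ._+_ (cong (ℚ._* y) (insertAt-lookup c j β))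
                     (sum-cong-≗ λ i → cong (ℚ._* v (punchIn j i) κ') (lift-punchIn c i)) ⟩
    β ℚ.* y ℚ.+ S κ'
      ≡⟨ solve 4 (λ s s' w y → (:- (s :* w)) :* y :+ s' := s' :+ s :* ((:- w) :* y)) refl (S κ) (S κ') a⁻¹ y ⟩
    S κ' ℚ.+ S κ ℚ.* z
      ≡⟨ cong (ℚ._+_ (S κ')) (*-distribʳ-sum z (λ i → c i ℚ.* v (punchIn j i) κ)) ⟩
    S κ' ℚ.+ sum (λ i → c i ℚ.* v (punchIn j i) κ ℚ.* z)
      ≡⟨ ∑-distrib-+ (λ i → c i ℚ.* v (punchIn j i) κ') (λ i → c i ℚ.* v (punchIn j i) κ ℚ.* z) ⟨
    sum (λ i → c i ℚ.* v (punchIn j i) κ' ℚ.+ c i ℚ.* v (punchIn j i) κ ℚ.* z)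
      ≡⟨ sum-cong-≗ (λ i → solve 5 (λ c u u' w y → c :* u' :+ c :* u :* ((:- w) :* y) := c :* (u' :- (u :* w) :* y))
                                   refl (c i) (v (punchIn j i) κ) (v (punchIn j i) κ') a⁻¹ y) ⟩
    lincomb c reduced κ'
      ∎
    where
    open ≡-Reasoning
    y z β : ℚ
    y = v j κ'
    z = (ℚ.- a⁻¹) ℚ.* y
    S : K → ℚ
    S = lincomb c (v ∘ punchIn j)
    β = ℚ.- (S κ ℚ.* a⁻¹)

homogeneous-nontrivial : ∀ {K : Set} (ks : List K) {m} (v : Fin m → K → ℚ) → List.length ks < m →
                         ∃ λ c → (∃ λ i → c i ≢ 0ℚ) × All (λ κ → lincomb c v κ ≡ 0ℚ) ks
homogeneous-nontrivial []       {suc m} v _ = (λ _ → 1ℚ) , (zero , ℚ.1≢0) , []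
homogeneous-nontrivial (κ ∷ ks) {suc m} v (s≤s |ks|<m) with Fin.any? (λ j → ¬? (v j κ ℚ.≟ 0ℚ))
... | no no-pivot =
  let c , nontrivial , solves = homogeneous-nontrivial ks v (ℕ.m<n⇒m<1+n |ks|<m)
  in  c , nontrivial , lincomb-0 c v κ column-zero ∷ solves
  where
  column-zero : ∀ j → v j κ ≡ 0ℚ
  column-zero j = decidable-stable (v j κ ℚ.≟ 0ℚ) (λ vⱼκ≢0 → no-pivot (j , vⱼκ≢0))
... | yes (j , vⱼκ≢0) =
  let c , (i , cᵢ≢0) , solves = homogeneous-nontrivial ks reduced |ks|<m
  in  lift c
    , (punchIn j i , subst (_≢ 0ℚ) (sym (lift-punchIn c i)) cᵢ≢0)
    , trans (lincomb-lift c κ) (lincomb-0 c reduced κ reduced-vanishes) ∷ All.map (trans (lincomb-lift c _)) solves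
  where open Pivot v κ j vⱼκ≢0

spans-supported : ∀ {K : Set} (ks : List K) {N} (v : Fin N → K → ℚ) (p : K → ℚ) → List.length ks ≤ N →
                  (∀ κ → κ ∈ ks ⊎ (p κ ≡ 0ℚ × ∀ i → v i κ ≡ 0ℚ)) →
                  (∀ c → (∀ κ → lincomb c v κ ≡ 0ℚ) → ∀ i → c i ≡ 0ℚ) →
                  ∃ λ c → ∀ κ → lincomb c v κ ≡ p κ
spans-supported {K} ks {N} v p |ks|≤N supported independent = from-solution (c₀ ℚ.≟ 0ℚ)
  where
  p∷v : Fin (suc N) → K → ℚ
  p∷v zero    = p
  p∷v (suc i) = v i

  solution : ∃ λ c → (∃ λ i → c i ≢ 0ℚ) × All (λ κ → lincomb c p∷v κ ≡ 0ℚ) ks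
  solution = homogeneous-nontrivial ks p∷v (s≤s |ks|≤N)

  c : Fin (suc N) → ℚ
  c = proj₁ solution

  c₀ : ℚ
  c₀ = c zero

  vanishes : ∀ κ → c₀ ℚ.* p κ ℚ.+ lincomb (c ∘ suc) v κ ≡ 0ℚ
  vanishes κ with supported κ
  ... | inj₁ κ∈ks          = All.lookup (proj₂ (proj₂ solution)) κ∈ks
  ... | inj₂ (pκ≡0 , vκ≡0) = lincomb-0 c p∷v κ λ { zero → pκ≡0 ; (suc i) → vκ≡0 i }

  rest≡ : ∀ κ → lincomb (c ∘ suc) v κ ≡ ℚ.- (c₀ ℚ.* p κ)
  rest≡ κ = begin
    rest                               ≡⟨ solve 2 (λ x l → l := (x :+ l) :+ (:- x)) refl (c₀ ℚ.* p κ) rest ⟩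
    (c₀ ℚ.* p κ ℚ.+ rest) ℚ.- c₀ ℚ.* p κ ≡⟨ cong (ℚ._- c₀ ℚ.* p κ) (vanishes κ) ⟩
    0ℚ ℚ.- c₀ ℚ.* p κ                   ≡⟨ ℚ.+-identityˡ (ℚ.- (c₀ ℚ.* p κ)) ⟩
    ℚ.- (c₀ ℚ.* p κ)                   ∎
    where
    open ≡-Reasoning
    rest : ℚ
    rest = lincomb (c ∘ suc) v κ

  from-solution : Dec (c₀ ≡ 0ℚ) → ∃ λ d → ∀ κ → lincomb d v κ ≡ p κ
  from-solution (yes c₀≡0) = contradiction (c≡0 i₀) cᵢ₀≢0
    where
    i₀ : Fin (suc N)
    i₀ = proj₁ (proj₁ (proj₂ solution))

    cᵢ₀≢0 : c i₀ ≢ 0ℚ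
    cᵢ₀≢0 = proj₂ (proj₁ (proj₂ solution))

    c≡0 : ∀ i → c i ≡ 0ℚ
    c≡0 zero    = c₀≡0
    c≡0 (suc i) = independent (c ∘ suc) rest≡0 i
      where
      rest≡0 : ∀ κ → lincomb (c ∘ suc) v κ ≡ 0ℚ
      rest≡0 κ = trans (rest≡ κ) (cong (λ a → ℚ.- a) (trans (cong (ℚ._* p κ) c₀≡0) (ℚ.*-zeroˡ (p κ))))
  from-solution (no c₀≢0) = (λ i → (ℚ.- c₀⁻¹) ℚ.* c (suc i)) , represents
    where
    instance _ = ℚ.≢-nonZero c₀≢0
    c₀⁻¹ : ℚ
    c₀⁻¹ = ℚ.1/ c₀

    represents : ∀ κ → lincomb (λ i → (ℚ.- c₀⁻¹) ℚ.* c (suc i)) v κ ≡ p κ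
    represents κ = begin
      sum (λ i → (ℚ.- c₀⁻¹) ℚ.* c (suc i) ℚ.* v i κ)
        ≡⟨ sum-cong-≗ (λ i → ℚ.*-assoc (ℚ.- c₀⁻¹) (c (suc i)) (v i κ)) ⟩
      sum (λ i → (ℚ.- c₀⁻¹) ℚ.* (c (suc i) ℚ.* v i κ))
        ≡⟨ *-distribˡ-sum (ℚ.- c₀⁻¹) (λ i → c (suc i) ℚ.* v i κ) ⟨
      (ℚ.- c₀⁻¹) ℚ.* lincomb (c ∘ suc) v κ
        ≡⟨ cong (ℚ._*_ (ℚ.- c₀⁻¹)) (rest≡ κ) ⟩
      (ℚ.- c₀⁻¹) ℚ.* (ℚ.- (c₀ ℚ.* p κ))
        ≡⟨ solve 3 (λ w c x → (:- w) :* (:- (c :* x)) := (w :* c) :* x) refl c₀⁻¹ c₀ (p κ) ⟩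
      (c₀⁻¹ ℚ.* c₀) ℚ.* p κ
        ≡⟨ cong (ℚ._* p κ) (ℚ.*-inverseˡ c₀) ⟩
      1ℚ ℚ.* p κ
        ≡⟨ ℚ.*-identityˡ (p κ) ⟩
      p κ ∎
      where open ≡-Reasoning

monomial : ∀ {r} → Vec ℕ r → (Fin r → ℚ) → ℚ
monomial []      x = 1ℚ
monomial (a ∷ e) x = x zero ^ a ℚ.* monomial e (x ∘ suc)

eval : ∀ {r} → Poly r → (Fin r → ℚ) → ℚ
eval []            x = 0ℚ
eval ((c , e) ∷ p) x = c ℚ.* monomial e x ℚ.+ eval p x

AllZero : ∀ {r} → Vec ℕ r → Set
AllZero e = ∀ i → lookup e i ≡ 0

record IsUnitVector {r} (s : Fin r) (e : Vec ℕ r) : Set where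
  field
    at-s      : lookup e s ≡ 1
    elsewhere : ∀ i → i ≢ s → lookup e i ≡ 0

IsUnitVector-∷ : ∀ {r s a} {e : Vec ℕ r} → IsUnitVector (suc s) (a ∷ e) → IsUnitVector s e
IsUnitVector-∷ unit = record
  { at-s      = IsUnitVector.at-s unit
  ; elsewhere = λ i i≢s → IsUnitVector.elsewhere unit (suc i) (i≢s ∘ Fin.suc-injective)
  }

-- The exponent vector of var s is built by a local function of Defs, so it cannot be named
-- here; the equation lets the unifier name it.
var-exponent : ∀ {r} (s : Fin r) {e} → var s ≡ (1ℚ , e) ∷ [] → IsUnitVector s e
var-exponent s {e} refl = record { at-s = at-s ; elsewhere = elsewhere }
  where
  at-s : lookup e s ≡ 1
  at-s with s Fin.≟ s | lookup e s ≡ _ ∋ Vec.lookup∘tabulate _ s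
  ... | yes _  | eq = eq
  ... | no s≢s | _  = contradiction refl s≢s

  elsewhere : ∀ i → i ≢ s → lookup e i ≡ 0
  elsewhere i i≢s with i Fin.≟ s | lookup e i ≡ _ ∋ Vec.lookup∘tabulate _ i
  ... | yes i≡s | _  = contradiction i≡s i≢s
  ... | no _    | eq = eq

monomial-zipWith-+ : ∀ {r} (e e' : Vec ℕ r) x → monomial (zipWith ℕ._+_ e e') x ≡ monomial e x ℚ.* monomial e' x
monomial-zipWith-+ []      []        x = sym (ℚ.*-identityˡ 1ℚ)
monomial-zipWith-+ (a ∷ e) (a' ∷ e') x = begin
  x₀ ^ (a ℕ.+ a') ℚ.* monomial (zipWith ℕ._+_ e e') (x ∘ suc)
    ≡⟨ cong₂ ℚ._*_ (^-homo-* x₀ a a') (monomial-zipWith-+ e e' (x ∘ suc)) ⟩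
  (x₀ ^ a ℚ.* x₀ ^ a') ℚ.* (monomial e (x ∘ suc) ℚ.* monomial e' (x ∘ suc))
    ≡⟨ solve 4 (λ p p' m m' → (p :* p') :* (m :* m') := (p :* m) :* (p' :* m')) refl
               (x₀ ^ a) (x₀ ^ a') (monomial e (x ∘ suc)) (monomial e' (x ∘ suc)) ⟩
  (x₀ ^ a ℚ.* monomial e (x ∘ suc)) ℚ.* (x₀ ^ a' ℚ.* monomial e' (x ∘ suc))
    ∎
  where
  open ≡-Reasoning
  x₀ : ℚ
  x₀ = x zero

monomial-zero : ∀ {r} (e : Vec ℕ r) x → AllZero e → monomial e x ≡ 1ℚ
monomial-zero []      x _   = refl
monomial-zero (a ∷ e) x e≡0 rewrite e≡0 zero | monomial-zero e (x ∘ suc) (e≡0 ∘ suc) = refl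

monomial-unit : ∀ {r} (e : Vec ℕ r) s x → IsUnitVector s e → monomial e x ≡ x s
monomial-unit (a ∷ e) zero    x unit
  rewrite IsUnitVector.at-s unit | monomial-zero e (x ∘ suc) (λ i → IsUnitVector.elsewhere unit (suc i) λ ())
  = trans (ℚ.*-identityʳ _) (ℚ.*-identityʳ (x zero))
monomial-unit (a ∷ e) (suc s) x unit
  rewrite IsUnitVector.elsewhere unit zero (λ ()) | monomial-unit e s (x ∘ suc) (IsUnitVector-∷ unit)
  = ℚ.*-identityˡ (x (suc s))

sum-zipWith-+ : ∀ {r} (e e' : Vec ℕ r) → Vec.sum (zipWith ℕ._+_ e e') ≡ Vec.sum e ℕ.+ Vec.sum e'
sum-zipWith-+ []      []        = refl
sum-zipWith-+ (a ∷ e) (a' ∷ e') rewrite sum-zipWith-+ e e' = +-interchange a a' (Vec.sum e) (Vec.sum e')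

sum-zero : ∀ {r} (e : Vec ℕ r) → AllZero e → Vec.sum e ≡ 0
sum-zero []      _   = refl
sum-zero (a ∷ e) e≡0 rewrite e≡0 zero = sum-zero e (e≡0 ∘ suc)

sum-unit : ∀ {r} (e : Vec ℕ r) s → IsUnitVector s e → Vec.sum e ≡ 1
sum-unit (a ∷ e) zero    unit rewrite IsUnitVector.at-s unit =
  cong suc (sum-zero e (λ i → IsUnitVector.elsewhere unit (suc i) λ ()))
sum-unit (a ∷ e) (suc s) unit rewrite IsUnitVector.elsewhere unit zero (λ ()) =
  sum-unit e s (IsUnitVector-∷ unit)

module _ {r : ℕ} (x : Fin r → ℚ) where

  eval-++ : ∀ (p q : Poly r) → eval (p ++ q) x ≡ eval p x ℚ.+ eval q x
  eval-++ []            q = sym (ℚ.+-identityˡ (eval q x))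
  eval-++ ((c , e) ∷ p) q rewrite eval-++ p q = sym (ℚ.+-assoc (c ℚ.* monomial e x) (eval p x) (eval q x))

  eval-scaleₚ : ∀ a (p : Poly r) → eval (scaleₚ a p) x ≡ a ℚ.* eval p x
  eval-scaleₚ a []            = sym (ℚ.*-zeroʳ a)
  eval-scaleₚ a ((c , e) ∷ p) rewrite eval-scaleₚ a p =
    solve 4 (λ a c m v → (a :* c) :* m :+ a :* v := a :* (c :* m :+ v)) refl a c (monomial e x) (eval p x)

  eval-minusₚ : ∀ (p q : Poly r) → eval (p -ₚ q) x ≡ eval p x ℚ.- eval q x
  eval-minusₚ p q rewrite eval-++ p (scaleₚ (ℚ.- 1ℚ) q) | eval-scaleₚ (ℚ.- 1ℚ) q =
    solve 2 (λ u v → u :+ (:- con 1ℚ) :* v := u :- v) refl (eval p x) (eval q x)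

  eval-*ₚ : ∀ (p q : Poly r) → eval (p *ₚ q) x ≡ eval p x ℚ.* eval q x
  eval-*ₚ []            q = sym (ℚ.*-zeroˡ (eval q x))
  eval-*ₚ ((c , e) ∷ p) q = begin
    eval (cXᵉ* q ++ p *ₚ q) x
      ≡⟨ eval-++ (cXᵉ* q) (p *ₚ q) ⟩
    eval (cXᵉ* q) x ℚ.+ eval (p *ₚ q) x
      ≡⟨ cong₂ ℚ._+_ (eval-cXᵉ* q) (eval-*ₚ p q) ⟩
    c ℚ.* monomial e x ℚ.* eval q x ℚ.+ eval p x ℚ.* eval q x
      ≡⟨ ℚ.*-distribʳ-+ (eval q x) (c ℚ.* monomial e x) (eval p x) ⟨
    (c ℚ.* monomial e x ℚ.+ eval p x) ℚ.* eval q x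
      ∎
    where
    open ≡-Reasoning
    cXᵉ* : Poly r → Poly r
    cXᵉ* = List.map (λ t → (c ℚ.* proj₁ t , zipWith ℕ._+_ e (proj₂ t)))

    eval-cXᵉ* : ∀ q → eval (cXᵉ* q) x ≡ c ℚ.* monomial e x ℚ.* eval q x
    eval-cXᵉ* []              = sym (ℚ.*-zeroʳ (c ℚ.* monomial e x))
    eval-cXᵉ* ((c' , e') ∷ q) rewrite eval-cXᵉ* q | monomial-zipWith-+ e e' x =
      solve 5 (λ c c' m m' v → (c :* c') :* (m :* m') :+ (c :* m) :* v := (c :* m) :* (c' :* m' :+ v))
              refl c c' (monomial e x) (monomial e' x) (eval q x)

  eval-constₚ : ∀ c → eval (constₚ c) x ≡ c
  eval-constₚ c rewrite monomial-zero (replicate r 0) x (λ i → Vec.lookup-replicate i 0) =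
    trans (ℚ.+-identityʳ (c ℚ.* 1ℚ)) (ℚ.*-identityʳ c)

  eval-var : ∀ s → eval (var s) x ≡ x s
  eval-var s rewrite monomial-unit _ s x (var-exponent s refl) = trans (ℚ.+-identityʳ (1ℚ ℚ.* x s)) (ℚ.*-identityˡ (x s))

  eval-prodₚ-map : ∀ {A : Set} (f : A → Poly r) xs →
                   eval (prodₚ (List.map f xs)) x ≡ product (List.map (λ a → eval (f a) x) xs)
  eval-prodₚ-map f []       = eval-constₚ 1ℚ
  eval-prodₚ-map f (a ∷ xs) =
    trans (eval-*ₚ (f a) (prodₚ (List.map f xs))) (cong (eval (f a) x ℚ.*_) (eval-prodₚ-map f xs))

  eval-binomₚ : ∀ y m → eval (binomₚ y m) x ≡ eval y x choose m
  eval-binomₚ y m =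
    trans (eval-scaleₚ (1/ m !) (prodₚ (List.map factor (upTo m))))
          (cong (1/ m ! ℚ.*_) (trans (eval-prodₚ-map factor (upTo m)) (cong product (List.map-cong eval-factor (upTo m)))))
    where
    factor : ℕ → Poly r
    factor i = y -ₚ constₚ (ℕtoℚ i)

    eval-factor : ∀ i → eval (factor i) x ≡ eval y x ℚ.- ℕtoℚ i
    eval-factor i = trans (eval-minusₚ y (constₚ (ℕtoℚ i))) (cong (ℚ._-_ (eval y x)) (eval-constₚ (ℕtoℚ i)))

eval-combₚ : ∀ {d r} (f : Vec ℕ d → Poly r) L x →
             eval (combₚ f L) x ≡ sumOver L (λ t → proj₁ t ℚ.* eval (f (proj₂ t)) x)
eval-combₚ f []            x = refl
eval-combₚ f ((c , u) ∷ L) x =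
  trans (eval-++ x (scaleₚ c (f u)) (combₚ f L)) (cong₂ ℚ._+_ (eval-scaleₚ x c (f u)) (eval-combₚ f L x))

module _ {r : ℕ} where

  coeff-++ : ∀ (p q : Poly r) e → coeff (p ++ q) e ≡ coeff p e ℚ.+ coeff q e
  coeff-++ []             q e = sym (ℚ.+-identityˡ (coeff q e))
  coeff-++ ((c , e') ∷ p) q e with ≡-dec ℕ._≟_ e' e
  ... | yes _ rewrite coeff-++ p q e = sym (ℚ.+-assoc c (coeff p e) (coeff q e))
  ... | no  _ = coeff-++ p q e

  coeff-scaleₚ : ∀ a (p : Poly r) e → coeff (scaleₚ a p) e ≡ a ℚ.* coeff p e
  coeff-scaleₚ a []             e = sym (ℚ.*-zeroʳ a)
  coeff-scaleₚ a ((c , e') ∷ p) e with ≡-dec ℕ._≟_ e' e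
  ... | yes _ rewrite coeff-scaleₚ a p e = sym (ℚ.*-distribˡ-+ a c (coeff p e))
  ... | no  _ = coeff-scaleₚ a p e

  coeff-term-≡ : ∀ c (e : Vec ℕ r) → coeff [ c , e ] e ≡ c
  coeff-term-≡ c e with ≡-dec ℕ._≟_ e e
  ... | yes _   = ℚ.+-identityʳ c
  ... | no  e≢e = contradiction refl e≢e

  coeff-term-≢ : ∀ c {e' e : Vec ℕ r} → e' ≢ e → coeff [ c , e' ] e ≡ 0ℚ
  coeff-term-≢ c {e'} {e} e'≢e with ≡-dec ℕ._≟_ e' e
  ... | yes e'≡e = contradiction e'≡e e'≢e
  ... | no  _    = refl

  coeff≢0⇒∈ : ∀ (p : Poly r) e → coeff p e ≢ 0ℚ → e ∈ List.map proj₂ p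
  coeff≢0⇒∈ []             e ≢0 = contradiction refl ≢0
  coeff≢0⇒∈ ((c , e') ∷ p) e ≢0 with ≡-dec ℕ._≟_ e' e
  ... | yes e'≡e = here (sym e'≡e)
  ... | no  _    = there (coeff≢0⇒∈ p e ≢0)

  eval≡sumOver-coeff : ∀ (p : Poly r) x {S} → Unique S → All (λ t → proj₂ t ∈ S) p →
                       eval p x ≡ sumOver S (λ e → coeff p e ℚ.* monomial e x)
  eval≡sumOver-coeff []             x {S} _      []          =
    sym (sumOver-0 S (All.tabulate λ {e} _ → ℚ.*-zeroˡ (monomial e x)))
  eval≡sumOver-coeff ((c , e') ∷ p) x {S} unique (e'∈S ∷ p⊆S) = begin
    c ℚ.* monomial e' x ℚ.+ eval p x
      ≡⟨ cong₂ ℚ._+_ head-term (eval≡sumOver-coeff p x unique p⊆S) ⟩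
    sumOver S (λ e → coeff [ c , e' ] e ℚ.* monomial e x) ℚ.+ sumOver S (λ e → coeff p e ℚ.* monomial e x)
      ≡⟨ sumOver-+ S _ _ ⟨
    sumOver S (λ e → coeff [ c , e' ] e ℚ.* monomial e x ℚ.+ coeff p e ℚ.* monomial e x)
      ≡⟨ sumOver-cong S (λ e → trans (cong (ℚ._* monomial e x) (coeff-++ [ c , e' ] p e))
                                     (ℚ.*-distribʳ-+ (monomial e x) (coeff [ c , e' ] e) (coeff p e))) ⟨
    sumOver S (λ e → coeff ((c , e') ∷ p) e ℚ.* monomial e x)
      ∎
    where
    open ≡-Reasoning
    other-terms-vanish : ∀ {e} → e ∈ S → e ≢ e' → coeff [ c , e' ] e ℚ.* monomial e x ≡ 0ℚ
    other-terms-vanish {e} _ e≢e' = trans (cong (ℚ._* monomial e x) (coeff-term-≢ c (e≢e' ∘ sym))) (ℚ.*-zeroˡ (monomial e x))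

    head-term : c ℚ.* monomial e' x ≡ sumOver S (λ e → coeff [ c , e' ] e ℚ.* monomial e x)
    head-term = sym (trans (sumOver-concentrated (λ e → e) (subst Unique (sym (List.map-id S)) unique) e'∈S
                                                 other-terms-vanish)
                           (cong (ℚ._* monomial e' x) (coeff-term-≡ c e')))

  eval-≈ₚzeroₚ : ∀ (p : Poly r) x → p ≈ₚ zeroₚ → eval p x ≡ 0ℚ
  eval-≈ₚzeroₚ p x p≈0 =
    trans (eval≡sumOver-coeff p x (deduplicate-! (≡-dec ℕ._≟_) (List.map proj₂ p)) p⊆S)
          (sumOver-0 S (All.tabulate λ {e} _ → trans (cong (ℚ._* monomial e x) (p≈0 e)) (ℚ.*-zeroˡ (monomial e x))))
    where
    S : List (Vec ℕ r)
    S = List.deduplicate (≡-dec ℕ._≟_) (List.map proj₂ p)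

    p⊆S : All (λ t → proj₂ t ∈ S) p
    p⊆S = All.tabulate (∈.∈-deduplicate⁺ (≡-dec ℕ._≟_) ∘ ∈.∈-map⁺ proj₂)

coeff-combₚ-tabulate : ∀ {d r N} (f : Vec ℕ d → Poly r) (c : Fin N → ℚ) (u : Fin N → Vec ℕ d) e →
                       coeff (combₚ f (List.tabulate (λ i → c i , u i))) e ≡ lincomb c (λ i → coeff (f (u i))) e
coeff-combₚ-tabulate {N = zero}  f c u e = refl
coeff-combₚ-tabulate {N = suc N} f c u e =
  trans (coeff-++ (scaleₚ (c zero) (f (u zero))) (combₚ f (List.tabulate (λ i → c (suc i) , u (suc i)))) e)
        (cong₂ ℚ._+_ (coeff-scaleₚ (c zero) (f (u zero)) e) (coeff-combₚ-tabulate f (c ∘ suc) (u ∘ suc) e))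

module _ {r : ℕ} where

  Deg≤ : ℕ → Poly r → Set
  Deg≤ b = All (λ t → Vec.sum (proj₂ t) ≤ b)

  Deg≤-weaken : ∀ {b b' p} → b ≤ b' → Deg≤ b p → Deg≤ b' p
  Deg≤-weaken b≤b' = All.map (λ ≤b → ℕ.≤-trans ≤b b≤b')

  Deg≤-scaleₚ : ∀ {b p} a → Deg≤ b p → Deg≤ b (scaleₚ a p)
  Deg≤-scaleₚ a = All.map⁺

  Deg≤-minusₚ : ∀ {b p q} → Deg≤ b p → Deg≤ b q → Deg≤ b (p -ₚ q)
  Deg≤-minusₚ deg-p deg-q = All.++⁺ deg-p (Deg≤-scaleₚ (ℚ.- 1ℚ) deg-q)

  Deg≤-*ₚ : ∀ {b b' p q} → Deg≤ b p → Deg≤ b' q → Deg≤ (b ℕ.+ b') (p *ₚ q)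
  Deg≤-*ₚ {p = []}          []              deg-q = []
  Deg≤-*ₚ {p = (c , e) ∷ p} (deg-e ∷ deg-p) deg-q = All.++⁺ (All.map⁺ (All.map shift deg-q)) (Deg≤-*ₚ deg-p deg-q)
    where
    shift : ∀ {e'} → Vec.sum e' ≤ _ → Vec.sum (zipWith ℕ._+_ e e') ≤ _
    shift deg-e' = ℕ.≤-trans (ℕ.≤-reflexive (sum-zipWith-+ e _)) (ℕ.+-mono-≤ deg-e deg-e')

  Deg≤-constₚ : ∀ c → Deg≤ 0 (constₚ c)
  Deg≤-constₚ c = ℕ.≤-reflexive (sum-zero (replicate r 0) (λ i → Vec.lookup-replicate i 0)) ∷ []

  Deg≤-var : ∀ s → Deg≤ 1 (var s)
  Deg≤-var s = ℕ.≤-reflexive (sum-unit _ s (var-exponent s refl)) ∷ []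

  Deg≤-prodₚ : ∀ {A : Set} (f : A → Poly r) (deg : A → ℕ) xs → (∀ a → Deg≤ (deg a) (f a)) →
               Deg≤ (ℕ.sum (List.map deg xs)) (prodₚ (List.map f xs))
  Deg≤-prodₚ f deg []       _     = Deg≤-constₚ 1ℚ
  Deg≤-prodₚ f deg (a ∷ xs) deg-f = Deg≤-*ₚ (deg-f a) (Deg≤-prodₚ f deg xs deg-f)

  Deg≤-binomₚ : ∀ {y} m → Deg≤ 1 y → Deg≤ m (binomₚ y m)
  Deg≤-binomₚ {y} m deg-y = Deg≤-scaleₚ (1/ m !) (subst (λ b → Deg≤ b (prodₚ (List.map factor (upTo m)))) ∑1≡m
    (Deg≤-prodₚ factor (λ _ → 1) (upTo m) deg-factor))
    where
    factor : ℕ → Poly r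
    factor i = y -ₚ constₚ (ℕtoℚ i)

    sum-ones : ∀ xs → ℕ.sum (List.map (λ _ → 1) xs) ≡ List.length xs
    sum-ones []       = refl
    sum-ones (_ ∷ xs) = cong suc (sum-ones xs)

    deg-factor : ∀ i → Deg≤ 1 (factor i)
    deg-factor i = Deg≤-minusₚ deg-y (Deg≤-weaken z≤n (Deg≤-constₚ (ℕtoℚ i)))

    ∑1≡m : ℕ.sum (List.map (λ _ → 1) (upTo m)) ≡ m
    ∑1≡m = trans (sum-ones (upTo m)) (List.length-upTo m)

  Deg≤⇒DegreeAtMost : ∀ {b k p} → Deg≤ b p → b ℕ.+ r ≤ k → DegreeAtMost k p
  Deg≤⇒DegreeAtMost {p = p} deg-p b+r≤k e coeff≢0 with ∈.∈-map⁻ proj₂ (coeff≢0⇒∈ p e coeff≢0)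
  ... | t , t∈p , refl = ℕ.≤-trans (ℕ.+-monoˡ-≤ r (All.lookup deg-p t∈p)) b+r≤k

DegreeAtMost-vanishes : ∀ {r k} (p : Poly r) → DegreeAtMost k p → ∀ e → ¬ (Vec.sum e ℕ.+ r ≤ k) → coeff p e ≡ 0ℚ
DegreeAtMost-vanishes p deg-p e too-high = decidable-stable (coeff p e ℚ.≟ 0ℚ) (too-high ∘ deg-p e)

-- Ascending sequences and exponent vectors

module _ {r' : ℕ} where

  last : Fin (suc r')
  last = fromℕ r'

  gap : (Fin (suc r') → ℕ) → Fin r' → ℕ
  gap U i = U (suc i) ∸ U (inject₁ i) ∸ 1

  record Ascending (k : ℕ) (U : Fin (suc r') → ℕ) : Set where
    field
      1≤first : 1 ≤ U zero
      step    : ∀ i → U (inject₁ i) < U (suc i)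
      last≤k  : U last ≤ k

  Ascending-weaken : ∀ {k n U} → k ≤ n → Ascending k U → Ascending n U
  Ascending-weaken k≤n asc = record
    { 1≤first = Ascending.1≤first asc
    ; step    = Ascending.step asc
    ; last≤k  = ℕ.≤-trans (Ascending.last≤k asc) k≤n
    }

first+gaps+r≡last : ∀ {r'} (U : Fin (suc r') → ℕ) → (∀ i → U (inject₁ i) < U (suc i)) →
                    U zero ℕ.+ ℕ.sum (List.map (gap U) (allFin r')) ℕ.+ r' ≡ U last
first+gaps+r≡last {zero}    U _    = trans (ℕ.+-identityʳ _) (ℕ.+-identityʳ (U zero))
first+gaps+r≡last {suc r''} U step = begin
  U zero ℕ.+ ℕ.sum (List.map (gap U) (allFin (suc r''))) ℕ.+ suc r''
    ≡⟨ cong (λ s → U zero ℕ.+ s ℕ.+ suc r'') (sum-map-allFin-suc r'' (gap U)) ⟩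
  U zero ℕ.+ (gap U zero ℕ.+ G) ℕ.+ suc r''
    ≡⟨ rearrange (U zero) (gap U zero) G r'' ⟩
  suc (U zero ℕ.+ gap U zero) ℕ.+ G ℕ.+ r''
    ≡⟨ cong (λ u → u ℕ.+ G ℕ.+ r'') (1+m+[n∸m∸1]≡n (step zero)) ⟩
  U (suc zero) ℕ.+ G ℕ.+ r''
    ≡⟨ first+gaps+r≡last (U ∘ suc) (step ∘ suc) ⟩
  U last ∎
  where
  open ≡-Reasoning
  G : ℕ
  G = ℕ.sum (List.map (gap (U ∘ suc)) (allFin r''))
  rearrange : ∀ a g G r → a ℕ.+ (g ℕ.+ G) ℕ.+ suc r ≡ suc (a ℕ.+ g) ℕ.+ G ℕ.+ r
  rearrange = solve-∀

≤-by-gaps : ∀ {r'} (U V : Fin (suc r') → ℕ) →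
            (∀ i → U (inject₁ i) < U (suc i)) → (∀ i → V (inject₁ i) < V (suc i)) →
            U zero ≤ V zero → (∀ i → gap U i ≤ gap V i) → ∀ s → U s ≤ V s
≤-by-gaps         U V _      _      U₀≤V₀ _        zero    = U₀≤V₀
≤-by-gaps {suc _} U V U-step V-step U₀≤V₀ gaps-≤ (suc s) =
  ≤-by-gaps (U ∘ suc) (V ∘ suc) (U-step ∘ suc) (V-step ∘ suc) U₁≤V₁ (gaps-≤ ∘ suc) s
  where
  open ℕ.≤-Reasoning
  U₁≤V₁ : U (suc zero) ≤ V (suc zero)
  U₁≤V₁ = begin
    U (suc zero)                        ≡⟨ 1+m+[n∸m∸1]≡n (U-step zero) ⟨
    suc (U zero ℕ.+ gap U zero)         ≤⟨ s≤s (ℕ.+-mono-≤ U₀≤V₀ (gaps-≤ zero)) ⟩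
    suc (V zero ℕ.+ gap V zero)         ≡⟨ 1+m+[n∸m∸1]≡n (V-step zero) ⟩
    V (suc zero)                        ∎

staircase : ∀ {m} → Vec ℕ (suc m) → Fin (suc m) → ℕ
staircase         (a ∷ e) zero    = suc a
staircase {suc m} (a ∷ e) (suc s) = suc a ℕ.+ staircase e s

staircase-pos : ∀ {m} (e : Vec ℕ (suc m)) s → 1 ≤ staircase e s
staircase-pos         (a ∷ e) zero    = s≤s z≤n
staircase-pos {suc m} (a ∷ e) (suc s) = s≤s z≤n

staircase-strictMono : ∀ {m} (e : Vec ℕ (suc m)) s₁ s₂ → toℕ s₁ < toℕ s₂ → staircase e s₁ < staircase e s₂
staircase-strictMono {suc m} (a ∷ e) zero     (suc s₂) _           = ℕ.m<m+n (suc a) (staircase-pos e s₂)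
staircase-strictMono {suc m} (a ∷ e) (suc s₁) (suc s₂) (s≤s s₁<s₂) =
  ℕ.+-monoʳ-< (suc a) (staircase-strictMono e s₁ s₂ s₁<s₂)

staircase-≤ : ∀ {m} (e : Vec ℕ (suc m)) s → staircase e s ≤ Vec.sum e ℕ.+ suc m
staircase-≤ {m}     (a ∷ e) zero    = begin
  suc a                         ≤⟨ s≤s (ℕ.≤-trans (ℕ.m≤m+n a (Vec.sum e)) (ℕ.m≤m+n (a ℕ.+ Vec.sum e) m)) ⟩
  suc (a ℕ.+ Vec.sum e ℕ.+ m)   ≡⟨ ℕ.+-suc (a ℕ.+ Vec.sum e) m ⟨
  a ℕ.+ Vec.sum e ℕ.+ suc m     ∎
  where open ℕ.≤-Reasoning
staircase-≤ {suc m} (a ∷ e) (suc s) = begin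
  suc a ℕ.+ staircase e s           ≤⟨ ℕ.+-monoʳ-≤ (suc a) (staircase-≤ e s) ⟩
  suc a ℕ.+ (Vec.sum e ℕ.+ suc m)   ≡⟨ rearrange a (Vec.sum e) m ⟩
  a ℕ.+ Vec.sum e ℕ.+ suc (suc m)   ∎
  where
  open ℕ.≤-Reasoning
  rearrange : ∀ a s m → suc a ℕ.+ (s ℕ.+ suc m) ≡ a ℕ.+ s ℕ.+ suc (suc m)
  rearrange = solve-∀

staircase-injective : ∀ {m} {e e' : Vec ℕ (suc m)} → (∀ s → staircase e s ≡ staircase e' s) → e ≡ e'
staircase-injective {zero}  {a ∷ []} {a' ∷ []} same = cong (_∷ []) (ℕ.suc-injective (same zero))
staircase-injective {suc m} {a ∷ e}  {a' ∷ e'} same with ℕ.suc-injective (same zero)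
... | refl = cong (a ∷_) (staircase-injective λ s → ℕ.+-cancelˡ-≡ (suc a) _ _ (same (suc s)))

incrementHead : ∀ {m} → Vec ℕ (suc m) → Vec ℕ (suc m)
incrementHead (a ∷ e) = suc a ∷ e

incrementHead-injective : ∀ {m} {e e' : Vec ℕ (suc m)} → incrementHead e ≡ incrementHead e' → e ≡ e'
incrementHead-injective {e = _ ∷ _} {_ ∷ _} refl = refl

0∷-injective : ∀ {m} {e e' : Vec ℕ m} → 0 ∷ e ≡ 0 ∷ e' → e ≡ e'
0∷-injective refl = refl

exponents : (m D : ℕ) → List (Vec ℕ m)
exponents zero    D       = [] ∷ []
exponents (suc m) zero    = List.map (0 ∷_) (exponents m 0)
exponents (suc m) (suc D) = List.map (0 ∷_) (exponents m (suc D)) ++ List.map incrementHead (exponents (suc m) D)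

∈-exponents⁻ : ∀ m D {e} → e ∈ exponents m D → Vec.sum e ≤ D
∈-exponents⁻ zero    D       {[]} _ = z≤n
∈-exponents⁻ (suc m) zero    e∈ with ∈.∈-map⁻ (0 ∷_) e∈
... | e' , e'∈ , refl = ∈-exponents⁻ m 0 e'∈
∈-exponents⁻ (suc m) (suc D) e∈ with ∈.∈-++⁻ (List.map (0 ∷_) (exponents m (suc D))) e∈
... | inj₁ e∈₀ with ∈.∈-map⁻ (0 ∷_) e∈₀
...   | e' , e'∈ , refl = ∈-exponents⁻ m (suc D) e'∈
∈-exponents⁻ (suc m) (suc D) e∈ | inj₂ e∈₊ with ∈.∈-map⁻ incrementHead e∈₊
...   | a ∷ e' , e'∈ , refl = s≤s (∈-exponents⁻ (suc m) D e'∈)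

∈-exponents⁺ : ∀ m D {e} → Vec.sum e ≤ D → e ∈ exponents m D
∈-exponents⁺ zero    D       {[]}        _         = here refl
∈-exponents⁺ (suc m) zero    {zero ∷ e}  e≤0       = ∈.∈-map⁺ (0 ∷_) (∈-exponents⁺ m 0 e≤0)
∈-exponents⁺ (suc m) (suc D) {zero ∷ e}  e≤D       = ∈.∈-++⁺ˡ (∈.∈-map⁺ (0 ∷_) (∈-exponents⁺ m (suc D) e≤D))
∈-exponents⁺ (suc m) (suc D) {suc a ∷ e} (s≤s e≤D) =
  ∈.∈-++⁺ʳ (List.map (0 ∷_) (exponents m (suc D))) (∈.∈-map⁺ incrementHead (∈-exponents⁺ (suc m) D {a ∷ e} e≤D))

exponents-unique : ∀ m D → Unique (exponents m D)
exponents-unique zero    D       = [] ∷ []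
exponents-unique (suc m) zero    = Unique.map⁺ 0∷-injective (exponents-unique m 0)
exponents-unique (suc m) (suc D) =
  Unique.++⁺ (Unique.map⁺ 0∷-injective (exponents-unique m (suc D)))
             (Unique.map⁺ incrementHead-injective (exponents-unique (suc m) D))
             disjoint
  where
  disjoint : ∀ {e} → e ∈ List.map (0 ∷_) (exponents m (suc D)) × e ∈ List.map incrementHead (exponents (suc m) D) → ⊥
  disjoint (e∈₀ , e∈₊) with ∈.∈-map⁻ (0 ∷_) e∈₀ | ∈.∈-map⁻ incrementHead e∈₊
  ... | _ , _ , refl | _ ∷ _ , _ , ()

-- γ as a polynomial in the ascending sequence (u_{1τ}, …, u_{rτ})

module _ {r' : ℕ} where

  ℓ-first : Poly (suc r')
  ℓ-first = var zero -ₚ constₚ 1ℚ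

  ℓ-step : Fin r' → Poly (suc r')
  ℓ-step i = (var (suc i) -ₚ var (inject₁ i)) -ₚ constₚ 1ℚ

  ℓ-last : ℕ → Poly (suc r')
  ℓ-last n = constₚ (ℕtoℚ n) -ₚ var last

  -- γ n k τ u is definitionally γₛ n k (uAt τ u).
  γₛ : (n k : ℕ) → (Fin (suc r') → ℕ) → Poly (suc r')
  γₛ n k U = binomₚ ℓ-first (U zero ∸ 1)
             *ₚ (prodₚ (List.map (λ i → binomₚ (ℓ-step i) (gap U i)) (allFin r'))
             *ₚ binomₚ (ℓ-last n) (k ∸ U last))

module _ {r' : ℕ} where

  Deg≤-ℓ-first : Deg≤ 1 (ℓ-first {r'})
  Deg≤-ℓ-first = Deg≤-minusₚ (Deg≤-var zero) (Deg≤-weaken z≤n (Deg≤-constₚ 1ℚ))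

  Deg≤-ℓ-step : ∀ i → Deg≤ 1 (ℓ-step {r'} i)
  Deg≤-ℓ-step i =
    Deg≤-minusₚ (Deg≤-minusₚ (Deg≤-var (suc i)) (Deg≤-var (inject₁ i))) (Deg≤-weaken z≤n (Deg≤-constₚ 1ℚ))

  Deg≤-ℓ-last : ∀ n → Deg≤ 1 (ℓ-last {r'} n)
  Deg≤-ℓ-last n = Deg≤-minusₚ (Deg≤-weaken z≤n (Deg≤-constₚ (ℕtoℚ n))) (Deg≤-var last)

  γₛ-degree : ∀ n k (U : Fin (suc r') → ℕ) → Ascending k U → DegreeAtMost k (γₛ n k U)
  γₛ-degree n k U asc = Deg≤⇒DegreeAtMost γₛ-Deg≤ (ℕ.≤-reflexive degree+r≡k)
    where
    G : ℕ
    G = ℕ.sum (List.map (gap U) (allFin r'))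

    γₛ-Deg≤ : Deg≤ ((U zero ∸ 1) ℕ.+ (G ℕ.+ (k ∸ U last))) (γₛ n k U)
    γₛ-Deg≤ = Deg≤-*ₚ (Deg≤-binomₚ (U zero ∸ 1) Deg≤-ℓ-first)
                (Deg≤-*ₚ (Deg≤-prodₚ (λ i → binomₚ (ℓ-step i) (gap U i)) (gap U) (allFin r')
                                     (λ i → Deg≤-binomₚ (gap U i) (Deg≤-ℓ-step i)))
                         (Deg≤-binomₚ (k ∸ U last) (Deg≤-ℓ-last n)))

    rearrange : ∀ a G b r → a ℕ.+ (G ℕ.+ b) ℕ.+ suc r ≡ suc a ℕ.+ G ℕ.+ r ℕ.+ b
    rearrange = solve-∀

    degree+r≡k : (U zero ∸ 1) ℕ.+ (G ℕ.+ (k ∸ U last)) ℕ.+ suc r' ≡ k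
    degree+r≡k = begin
      (U zero ∸ 1) ℕ.+ (G ℕ.+ (k ∸ U last)) ℕ.+ suc r'
        ≡⟨ rearrange (U zero ∸ 1) G (k ∸ U last) r' ⟩
      suc (U zero ∸ 1) ℕ.+ G ℕ.+ r' ℕ.+ (k ∸ U last)
        ≡⟨ cong (λ u → u ℕ.+ G ℕ.+ r' ℕ.+ (k ∸ U last)) (ℕ.m+[n∸m]≡n (Ascending.1≤first asc)) ⟩
      U zero ℕ.+ G ℕ.+ r' ℕ.+ (k ∸ U last)
        ≡⟨ cong (ℕ._+ (k ∸ U last)) (first+gaps+r≡last U (Ascending.step asc)) ⟩
      U last ℕ.+ (k ∸ U last)
        ≡⟨ ℕ.m+[n∸m]≡n (Ascending.last≤k asc) ⟩
      k ∎
      where open ≡-Reasoning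

module _ {r' : ℕ} (V : Fin (suc r') → ℕ) where

  eval-ℓ-first : 1 ≤ V zero → eval ℓ-first (ℕtoℚ ∘ V) ≡ ℕtoℚ (V zero ∸ 1)
  eval-ℓ-first 1≤V₀ = begin
    eval (var zero -ₚ constₚ 1ℚ) x       ≡⟨ eval-minusₚ x (var zero) (constₚ 1ℚ) ⟩
    eval (var zero) x ℚ.- eval (constₚ 1ℚ) x ≡⟨ cong₂ ℚ._-_ (eval-var x zero) (eval-constₚ x 1ℚ) ⟩
    ℕtoℚ (V zero) ℚ.- 1ℚ                   ≡⟨ ℕtoℚ-∸ 1≤V₀ ⟩
    ℕtoℚ (V zero ∸ 1)                      ∎
    where
    open ≡-Reasoning
    x : Fin (suc r') → ℚ
    x = ℕtoℚ ∘ V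

  eval-ℓ-step : ∀ i → V (inject₁ i) < V (suc i) → eval (ℓ-step i) (ℕtoℚ ∘ V) ≡ ℕtoℚ (gap V i)
  eval-ℓ-step i Vᵢ<Vᵢ₊₁ = begin
    eval ((var (suc i) -ₚ var (inject₁ i)) -ₚ constₚ 1ℚ) x
      ≡⟨ eval-minusₚ x (var (suc i) -ₚ var (inject₁ i)) (constₚ 1ℚ) ⟩
    eval (var (suc i) -ₚ var (inject₁ i)) x ℚ.- eval (constₚ 1ℚ) x
      ≡⟨ cong₂ ℚ._-_ (eval-minusₚ x (var (suc i)) (var (inject₁ i))) (eval-constₚ x 1ℚ) ⟩
    (eval (var (suc i)) x ℚ.- eval (var (inject₁ i)) x) ℚ.- 1ℚ
      ≡⟨ cong (ℚ._- 1ℚ) (cong₂ ℚ._-_ (eval-var x (suc i)) (eval-var x (inject₁ i))) ⟩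
    (ℕtoℚ (V (suc i)) ℚ.- ℕtoℚ (V (inject₁ i))) ℚ.- 1ℚ
      ≡⟨ cong (ℚ._- 1ℚ) (ℕtoℚ-∸ (ℕ.<⇒≤ Vᵢ<Vᵢ₊₁)) ⟩
    ℕtoℚ (V (suc i) ∸ V (inject₁ i)) ℚ.- 1ℚ
      ≡⟨ ℕtoℚ-∸ (ℕ.m<n⇒0<n∸m Vᵢ<Vᵢ₊₁) ⟩
    ℕtoℚ (gap V i) ∎
    where
    open ≡-Reasoning
    x : Fin (suc r') → ℚ
    x = ℕtoℚ ∘ V

  eval-ℓ-last : ∀ n → V last ≤ n → eval (ℓ-last n) (ℕtoℚ ∘ V) ≡ ℕtoℚ (n ∸ V last)
  eval-ℓ-last n V≤n = begin
    eval (constₚ (ℕtoℚ n) -ₚ var last) x           ≡⟨ eval-minusₚ x (constₚ (ℕtoℚ n)) (var last) ⟩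
    eval (constₚ (ℕtoℚ n)) x ℚ.- eval (var last) x ≡⟨ cong₂ ℚ._-_ (eval-constₚ x (ℕtoℚ n)) (eval-var x last) ⟩
    ℕtoℚ n ℚ.- ℕtoℚ (V last)                       ≡⟨ ℕtoℚ-∸ V≤n ⟩
    ℕtoℚ (n ∸ V last)                              ∎
    where
    open ≡-Reasoning
    x : Fin (suc r') → ℚ
    x = ℕtoℚ ∘ V

  eval-γₛ : ∀ n k U → Ascending n V →
            eval (γₛ n k U) (ℕtoℚ ∘ V) ≡
              ℕtoℚ (V zero ∸ 1) choose (U zero ∸ 1)
              ℚ.* (product (List.map (λ i → ℕtoℚ (gap V i) choose gap U i) (allFin r'))
              ℚ.* ℕtoℚ (n ∸ V last) choose (k ∸ U last))
  eval-γₛ n k U asc =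
    trans (eval-*ₚ x first (steps *ₚ final))
          (cong₂ ℚ._*_ eval-first (trans (eval-*ₚ x steps final) (cong₂ ℚ._*_ eval-steps eval-final)))
    where
    x : Fin (suc r') → ℚ
    x = ℕtoℚ ∘ V

    first : Poly (suc r')
    first = binomₚ ℓ-first (U zero ∸ 1)

    steps : Poly (suc r')
    steps = prodₚ (List.map (λ i → binomₚ (ℓ-step i) (gap U i)) (allFin r'))

    final : Poly (suc r')
    final = binomₚ (ℓ-last n) (k ∸ U last)

    eval-binomₚ-at : ∀ y a m → eval y x ≡ ℕtoℚ a → eval (binomₚ y m) x ≡ ℕtoℚ a choose m
    eval-binomₚ-at y a m y≡a = trans (eval-binomₚ x y m) (cong (_choose m) y≡a)

    eval-first : eval first x ≡ ℕtoℚ (V zero ∸ 1) choose (U zero ∸ 1)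
    eval-first = eval-binomₚ-at ℓ-first (V zero ∸ 1) (U zero ∸ 1) (eval-ℓ-first (Ascending.1≤first asc))

    eval-final : eval final x ≡ ℕtoℚ (n ∸ V last) choose (k ∸ U last)
    eval-final = eval-binomₚ-at (ℓ-last n) (n ∸ V last) (k ∸ U last) (eval-ℓ-last n (Ascending.last≤k asc))

    eval-steps : eval steps x ≡ product (List.map (λ i → ℕtoℚ (gap V i) choose gap U i) (allFin r'))
    eval-steps = trans (eval-prodₚ-map x (λ i → binomₚ (ℓ-step i) (gap U i)) (allFin r'))
                       (cong product (List.map-cong (λ i → eval-binomₚ-at (ℓ-step i) (gap V i) (gap U i)
                                                                           (eval-ℓ-step i (Ascending.step asc i)))
                                                    (allFin r')))

module _ {r' : ℕ} (n k : ℕ) where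

  γₛ≢0⇒≤ : ∀ (U V : Fin (suc r') → ℕ) → (∀ i → U (inject₁ i) < U (suc i)) → Ascending n V →
           eval (γₛ n k U) (ℕtoℚ ∘ V) ≢ 0ℚ → ∀ s → U s ≤ V s
  γₛ≢0⇒≤ U V U-step asc γU[V]≢0 = ≤-by-gaps U V U-step (Ascending.step asc) U₀≤V₀ gaps-≤
    where
    first steps final : ℚ
    first = ℕtoℚ (V zero ∸ 1) choose (U zero ∸ 1)
    steps = product (List.map (λ i → ℕtoℚ (gap V i) choose gap U i) (allFin r'))
    final = ℕtoℚ (n ∸ V last) choose (k ∸ U last)

    value≢0 : first ℚ.* (steps ℚ.* final) ≢ 0ℚ
    value≢0 = subst (_≢ 0ℚ) (eval-γₛ V n k U asc) γU[V]≢0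

    first≢0 : first ≢ 0ℚ
    first≢0 = p*q≢0⇒p≢0 (steps ℚ.* final) value≢0

    steps≢0 : steps ≢ 0ℚ
    steps≢0 = p*q≢0⇒p≢0 final (p*q≢0⇒q≢0 first value≢0)

    U₀≤V₀ : U zero ≤ V zero
    U₀≤V₀ = m∸1≤n∸1⇒m≤n (Ascending.1≤first asc) (choose≢0⇒≤ (V zero ∸ 1) (U zero ∸ 1) first≢0)

    gaps-≤ : ∀ i → gap U i ≤ gap V i
    gaps-≤ i = choose≢0⇒≤ (gap V i) (gap U i) (All.lookup (All.map⁻ (product≢0⇒≢0 _ steps≢0)) (∈.∈-allFin i))

  γₛ-diagonal≢0 : ∀ (U : Fin (suc r') → ℕ) → k ≤ n → Ascending k U → eval (γₛ n k U) (ℕtoℚ ∘ U) ≢ 0ℚ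
  γₛ-diagonal≢0 U k≤n asc = subst (_≢ 0ℚ) (sym (eval-γₛ U n k U (Ascending-weaken k≤n asc)))
    (p≢0∧q≢0⇒p*q≢0 (choose-≢0 (U zero ∸ 1) (U zero ∸ 1) ℕ.≤-refl) (p≢0∧q≢0⇒p*q≢0 steps≢0 final≢0))
    where
    steps≢0 : product (List.map (λ i → ℕtoℚ (gap U i) choose gap U i) (allFin r')) ≢ 0ℚ
    steps≢0 = product-≢0 (All.map⁺ (All.tabulate {xs = allFin r'} λ {i} _ → choose-≢0 (gap U i) (gap U i) ℕ.≤-refl))
    final≢0 : ℕtoℚ (n ∸ U last) choose (k ∸ U last) ≢ 0ℚ
    final≢0 = choose-≢0 (n ∸ U last) (k ∸ U last) (ℕ.∸-monoˡ-≤ (U last) k≤n)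

minPre-complete : ∀ {d r} (τ : Fin d → Fin r) {s} j → τ j ≡ s → ∃ λ j' → minPre τ s ≡ just j' × τ j' ≡ s
minPre-complete {suc d} τ {s} j τj≡s with τ zero Fin.≟ s
... | yes τ₀≡s = zero , refl , τ₀≡s
minPre-complete {suc d} τ zero    τ₀≡s | no τ₀≢s = contradiction τ₀≡s τ₀≢s
minPre-complete {suc d} τ (suc j) τj≡s | no _ with minPre-complete (τ ∘ suc) j τj≡s
... | j' , ≡just , τj'≡s = suc j' , cong (Maybe.map suc) ≡just , τj'≡s

module _ {d r' : ℕ} (τ : Fin d → Fin (suc r')) where

  fromExponent : Vec ℕ (suc r') → Vec ℕ d
  fromExponent e = Vec.tabulate (staircase e ∘ τ)

  fromExponent-InU : ∀ {k} e → Vec.sum e ℕ.+ suc r' ≤ k → InU k τ (fromExponent e)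
  fromExponent-InU {k} e e+r≤k = bounds , order
    where
    u : Vec ℕ d
    u = fromExponent e

    bounds : ∀ j → 1 ≤ lookup u j × lookup u j ≤ k
    bounds j rewrite Vec.lookup∘tabulate (staircase e ∘ τ) j =
      staircase-pos e (τ j) , ℕ.≤-trans (staircase-≤ e (τ j)) e+r≤k

    order : ∀ j₁ j₂ → toℕ j₁ < toℕ j₂ →
            (toℕ (τ j₁) < toℕ (τ j₂) → lookup u j₁ < lookup u j₂) ×
            (τ j₁ ≡ τ j₂ → lookup u j₁ ≡ lookup u j₂) ×
            (toℕ (τ j₂) < toℕ (τ j₁) → lookup u j₂ < lookup u j₁)
    order j₁ j₂ _ rewrite Vec.lookup∘tabulate (staircase e ∘ τ) j₁ | Vec.lookup∘tabulate (staircase e ∘ τ) j₂ =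
      staircase-strictMono e (τ j₁) (τ j₂) , cong (staircase e) , staircase-strictMono e (τ j₂) (τ j₁)

module _ {d r' : ℕ} (τ : Fin d → Fin (suc r')) (surj : Surjective _≡_ _≡_ τ) where

  uAt-attained : ∀ u s → ∃ λ j → τ j ≡ s × uAt τ u s ≡ lookup u j
  uAt-attained u s with surj s
  ... | j , τj≡s with minPre-complete τ j (τj≡s refl)
  ... | j' , ≡just , τj'≡s rewrite ≡just = j' , τj'≡s , refl

  module _ {k} (u : Vec ℕ d) (u∈U : InU k τ u) where

    InU-same : ∀ j₁ j₂ → τ j₁ ≡ τ j₂ → lookup u j₁ ≡ lookup u j₂
    InU-same j₁ j₂ τ≡ with Fin.<-cmp j₁ j₂
    ... | tri< j₁<j₂ _ _ = proj₁ (proj₂ (proj₂ u∈U j₁ j₂ j₁<j₂)) τ≡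
    ... | tri≈ _ refl _  = refl
    ... | tri> _ _ j₂<j₁ = sym (proj₁ (proj₂ (proj₂ u∈U j₂ j₁ j₂<j₁)) (sym τ≡))

    InU-order : ∀ j₁ j₂ → toℕ (τ j₁) < toℕ (τ j₂) → lookup u j₁ < lookup u j₂
    InU-order j₁ j₂ τ< with Fin.<-cmp j₁ j₂
    ... | tri< j₁<j₂ _ _ = proj₁ (proj₂ u∈U j₁ j₂ j₁<j₂) τ<
    ... | tri≈ _ refl _  = contradiction τ< (ℕ.<-irrefl refl)
    ... | tri> _ _ j₂<j₁ = proj₂ (proj₂ (proj₂ u∈U j₂ j₁ j₂<j₁)) τ<

    lookup≡uAt∘τ : ∀ j → lookup u j ≡ uAt τ u (τ j)
    lookup≡uAt∘τ j with uAt-attained u (τ j)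
    ... | j' , τj'≡τj , uAt≡ = trans (InU-same j j' (sym τj'≡τj)) (sym uAt≡)

    uAt-ascending : Ascending k (uAt τ u)
    uAt-ascending = record
      { 1≤first = proj₁ (bounds zero)
      ; step    = λ i → order (inject₁ i) (suc i) (s≤s (ℕ.≤-reflexive (Fin.toℕ-inject₁ i)))
      ; last≤k  = proj₂ (bounds last)
      }
      where
      bounds : ∀ s → 1 ≤ uAt τ u s × uAt τ u s ≤ k
      bounds s with uAt-attained u s
      ... | j , _ , uAt≡ rewrite uAt≡ = proj₁ u∈U j

      order : ∀ s₁ s₂ → toℕ s₁ < toℕ s₂ → uAt τ u s₁ < uAt τ u s₂
      order s₁ s₂ s₁<s₂ with uAt-attained u s₁ | uAt-attained u s₂
      ... | j₁ , refl , uAt≡₁ | j₂ , refl , uAt≡₂ rewrite uAt≡₁ | uAt≡₂ = InU-order j₁ j₂ s₁<s₂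

  InU-injective : ∀ {k u u'} → InU k τ u → InU k τ u' → (∀ s → uAt τ u s ≡ uAt τ u' s) → u ≡ u'
  InU-injective {u = u} {u'} u∈U u'∈U same = begin
    u                                  ≡⟨ Vec.tabulate∘lookup u ⟨
    Vec.tabulate (lookup u)            ≡⟨ Vec.tabulate-cong lookup-same ⟩
    Vec.tabulate (lookup u')           ≡⟨ Vec.tabulate∘lookup u' ⟩
    u'                                 ∎
    where
    open ≡-Reasoning
    lookup-same : ∀ j → lookup u j ≡ lookup u' j
    lookup-same j = trans (lookup≡uAt∘τ u u∈U j) (trans (same (τ j)) (sym (lookup≡uAt∘τ u' u'∈U j)))

  γ-degree : ∀ n {k} u → InU k τ u → DegreeAtMost k (γ n k τ u)
  γ-degree n {k} u u∈U = γₛ-degree n k (uAt τ u) (uAt-ascending u u∈U)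

  uAt-fromExponent : ∀ e s → uAt τ (fromExponent τ e) s ≡ staircase e s
  uAt-fromExponent e s with uAt-attained (fromExponent τ e) s
  ... | j , τj≡s , uAt≡ = trans uAt≡ (trans (Vec.lookup∘tabulate (staircase e ∘ τ) j) (cong (staircase e) τj≡s))

  fromExponent-injective : ∀ {e e'} → fromExponent τ e ≡ fromExponent τ e' → e ≡ e'
  fromExponent-injective {e} {e'} same = staircase-injective λ s →
    trans (sym (uAt-fromExponent e s)) (trans (cong (λ u → uAt τ u s) same) (uAt-fromExponent e' s))

-- The basis

module _ {d r' n k : ℕ} (k≤n : k ≤ n) (τ : Fin d → Fin (suc r')) (surj : Surjective _≡_ _≡_ τ) where

  private
    weight : Vec ℕ d → ℕ
    weight u = ℕ.sum (List.map (uAt τ u) (allFin (suc r')))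

    ev : Vec ℕ d → Vec ℕ d → ℚ
    ev u v = eval (γ n k τ u) (ℕtoℚ ∘ uAt τ v)

    ev-diagonal : ∀ v → InU k τ v → ev v v ≢ 0ℚ
    ev-diagonal v v∈U = γₛ-diagonal≢0 n k (uAt τ v) k≤n (uAt-ascending τ surj v v∈U)

    ev-triangular : ∀ u v → InU k τ u → InU k τ v → ev u v ≢ 0ℚ → u ≢ v → weight u < weight v
    ev-triangular u v u∈U v∈U ev≢0 u≢v = ℕ.≤∧≢⇒< (sum-map-mono-≤ (allFin (suc r')) U≤V) (u≢v ∘ weight≡⇒≡)
      where
      U≤V : ∀ s → uAt τ u s ≤ uAt τ v s
      U≤V = γₛ≢0⇒≤ n k (uAt τ u) (uAt τ v) (Ascending.step (uAt-ascending τ surj u u∈U))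
                   (Ascending-weaken k≤n (uAt-ascending τ surj v v∈U)) ev≢0

      weight≡⇒≡ : weight u ≡ weight v → u ≡ v
      weight≡⇒≡ weight≡ = InU-injective τ surj u∈U v∈U λ s →
        All.lookup (sum-map-≤∧≡⇒≡ (allFin (suc r')) U≤V weight≡) (∈.∈-allFin s)

  γ-independent : ∀ (L : List (ℚ × Vec ℕ d)) → All (λ t → InU k τ (proj₂ t)) L → Unique (List.map proj₂ L) →
                  combₚ (γ n k τ) L ≈ₚ zeroₚ → All (λ t → proj₁ t ≡ 0ℚ) L
  γ-independent L L⊆U unique comb≈0 =
    triangular⇒independent (InU k τ) weight ev ev-diagonal ev-triangular L L⊆U unique λ v _ →
      trans (sym (eval-combₚ (γ n k τ) L (ℕtoℚ ∘ uAt τ v)))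
            (eval-≈ₚzeroₚ (combₚ (γ n k τ) L) (ℕtoℚ ∘ uAt τ v) comb≈0)

  Spanned : Poly (suc r') → Set
  Spanned p = ∃ λ (L : List (ℚ × Vec ℕ d)) → All (λ t → InU k τ (proj₂ t)) L × (combₚ (γ n k τ) L ≈ₚ p)

  γ-spanning-≤ : suc r' ≤ k → ∀ p → DegreeAtMost k p → Spanned p
  γ-spanning-≤ r≤k p deg-p = terms c , All.tabulate⁺ idx∈U , λ e →
    trans (coeff-combₚ-tabulate (γ n k τ) c idx e) (represents e)
    where
    E : List (Vec ℕ (suc r'))
    E = exponents (suc r') (k ∸ suc r')

    N : ℕ
    N = List.length E

    idx : Fin N → Vec ℕ d
    idx i = fromExponent τ (List.lookup E i)

    idx∈U : ∀ i → InU k τ (idx i)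
    idx∈U i = fromExponent-InU τ (List.lookup E i)
                (ℕ.m≤o∸n⇒m+n≤o _ r≤k (∈-exponents⁻ (suc r') (k ∸ suc r') (∈.∈-lookup i)))

    v : Fin N → Vec ℕ (suc r') → ℚ
    v i = coeff (γ n k τ (idx i))

    terms : (Fin N → ℚ) → List (ℚ × Vec ℕ d)
    terms c = List.tabulate (λ i → c i , idx i)

    supported : ∀ e → e ∈ E ⊎ (coeff p e ≡ 0ℚ × ∀ i → v i e ≡ 0ℚ)
    supported e = case Vec.sum e ℕ.+ suc r' ℕ.≤? k of λ where
      (yes e+r≤k) → inj₁ (∈-exponents⁺ (suc r') (k ∸ suc r') (ℕ.m+n≤o⇒m≤o∸n (Vec.sum e) e+r≤k))
      (no  e+r≰k) → inj₂ (DegreeAtMost-vanishes p deg-p e e+r≰k , λ i →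
                      DegreeAtMost-vanishes (γ n k τ (idx i)) (γ-degree τ surj n (idx i) (idx∈U i)) e e+r≰k)

    terms-unique : ∀ c → Unique (List.map proj₂ (terms c))
    terms-unique c = subst Unique (sym keys≡)
                       (Unique.map⁺ (fromExponent-injective τ surj) (exponents-unique (suc r') (k ∸ suc r')))
      where
      keys≡ : List.map proj₂ (terms c) ≡ List.map (fromExponent τ) E
      keys≡ = trans (List.map-tabulate (λ i → c i , idx i) proj₂)
                    (trans (sym (List.map-tabulate (List.lookup E) (fromExponent τ)))
                           (cong (List.map (fromExponent τ)) (List.tabulate-lookup E)))

    independent : ∀ c → (∀ e → lincomb c v e ≡ 0ℚ) → ∀ i → c i ≡ 0ℚ
    independent c vanish = All.tabulate⁻ (γ-independent (terms c) (All.tabulate⁺ idx∈U) (terms-unique c) λ e →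
                                            trans (coeff-combₚ-tabulate (γ n k τ) c idx e) (vanish e))

    solution : ∃ λ c → ∀ e → lincomb c v e ≡ coeff p e
    solution = spans-supported E v (coeff p) ℕ.≤-refl supported independent

    c : Fin N → ℚ
    c = proj₁ solution

    represents : ∀ e → lincomb c v e ≡ coeff p e
    represents = proj₂ solution

  γ-spanning : ∀ p → DegreeAtMost k p → Spanned p
  γ-spanning p deg-p = case suc r' ℕ.≤? k of λ where
    (yes r≤k) → γ-spanning-≤ r≤k p deg-p
    (no  r≰k) → [] , [] , λ e →
      sym (DegreeAtMost-vanishes p deg-p e (r≰k ∘ ℕ.≤-trans (ℕ.m≤n+m (suc r') (Vec.sum e))))

lemma22 : (d k n r : ℕ) → 3 ≤ d → 1 ≤ k → k ≤ n → 1 ≤ r → r ≤ d →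
          (τ : Fin d → Fin r) → Surjective _≡_ _≡_ τ →
          IsBasis (InU k τ) (γ n k τ) (DegreeAtMost k)
lemma22 d k n zero     _ _ _   () _ τ surj
lemma22 d k n (suc r') _ _ k≤n _  _ τ surj = record
  { members     = γ-degree τ surj n
  ; spanning    = γ-spanning k≤n τ surj
  ; independent = γ-independent k≤n τ surj
  }
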